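{- Let $n \ge 3$ and $2 \le k \le n-1$ be integers, let $c_1,\ldots,c_r \ge 1$ be integers with $d = c_1 + \cdots + c_r$, let $G = T(n,k,(c_1,\ldots,c_r))$ and $t(v_i) = t(G, v_i, v_n)$. Then \[ t(v_i) = \begin{cases} n^2 - k^2 + 2(d-1)(n-k) + (k-1)^2 - (i-1)^2, & 1 \le i \le k-1,\\ n^2 - i^2 + 2(d-1)(n-i), & k \le i \le n-1. \end{cases} \]
   Context: $T(n,k,(c_1,\ldots,c_r))$ is the tree consisting of a path (spine) $v_1 v_2 \cdots v_n$ together with $r$ vertex-disjoint pendant paths $S_1,\ldots,S_r$ attached at $v_k$: $S_i$ has $c_i$ vertices, one endpoint $u_i$ of $S_i$ is adjacent to $v_k$, the other endpoint has degree $1$, and internal vertices have degree $2$ (for $c_i=1$, $S_i$ is a single leaf adjacent to $v_k$). $t(G,v,u)$ denotes the expected number of steps until a simple random walk on $G$ started at $v$ (moving each step to a uniformly random neighbor) first reaches $u$. -}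

module Defs where

open import Data.Bool using (Bool; true; false; _∧_; _∨_; if_then_else_)
open import Data.Nat as ℕ using (ℕ; zero; suc; _∸_)
open import Data.Nat.Base using (_≡ᵇ_)
open import Data.Integer as ℤ using (ℤ; +_)
open import Data.List using (List; []; _∷_; foldr; map; upTo; length; filter)
open import Data.Nat.ListAction using (sum)
open import Data.Product using (_×_; _,_; Σ)
open import Data.Rational as ℚ using (ℚ; 0ℚ; 1ℚ; _/_)

-- The tree T(n,k,(c_1,...,c_r)) as a concrete graph on vertices
-- 0 .. N-1 with N = n + (c_1+...+c_r).
--   * spine vertex v_i (1 ≤ i ≤ n)  has label i-1
--   * the pendant path S_j occupies labels o_j, ..., o_j + c_j - 1,
--     where o_j = n + c_1 + ... + c_(j-1); label o_j is u_j (adjacent to v_k),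
--     consecutive labels inside S_j are adjacent.

Edge : Set
Edge = ℕ × ℕ

spineEdges : ℕ → List Edge
spineEdges n = map (λ i → (i , suc i)) (upTo (n ∸ 1))

pathEdges : ℕ → ℕ → List Edge
pathEdges o c = map (λ p → (o ℕ.+ p , o ℕ.+ suc p)) (upTo (c ∸ 1))

pendantEdges : ℕ → ℕ → List ℕ → List Edge
pendantEdges a o []       = []
pendantEdges a o (c ∷ cs) =
  ((a , o) ∷ pathEdges o c) Data.List.++ pendantEdges a (o ℕ.+ c) cs

TEdges : ℕ → ℕ → List ℕ → List Edge
TEdges n k cs = spineEdges n Data.List.++ pendantEdges (k ∸ 1) n cs

TSize : ℕ → List ℕ → ℕ
TSize n cs = n ℕ.+ sum cs

record Graph : Set where
  field
    size  : ℕ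
    edges : List Edge
open Graph public

T : ℕ → ℕ → List ℕ → Graph
T n k cs = record { size = TSize n cs ; edges = TEdges n k cs }

adj : Graph → ℕ → ℕ → Bool
adj G u v = foldr (λ e b → (((Data.Product.proj₁ e ≡ᵇ u) ∧ (Data.Product.proj₂ e ≡ᵇ v))
                           ∨ ((Data.Product.proj₁ e ≡ᵇ v) ∧ (Data.Product.proj₂ e ≡ᵇ u))) ∨ b)
                  false (edges G)

vertices : Graph → List ℕ
vertices G = upTo (size G)

degree : Graph → ℕ → ℕ
degree G v = length (filter (λ w → Data.Bool.T? (adj G v w)) (vertices G))

-- 1 / deg(v)  (deg(v) ≥ 1 for every vertex of the trees considered;
-- the value for an isolated vertex is irrelevant and set to 0)
invDeg : Graph → ℕ → ℚ
invDeg G v with degree G v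
... | zero  = 0ℚ
... | suc m = + 1 / suc m

sumℚ : List ℚ → ℚ
sumℚ = foldr ℚ._+_ 0ℚ

-- Simple random walk started at s, killed on reaching the target u.
-- walk G s u m w = P(X_m = w and X_j ≠ u for all j < m).

δ : ℕ → ℕ → ℚ
δ s w = if s ≡ᵇ w then 1ℚ else 0ℚ

walk : Graph → ℕ → ℕ → ℕ → ℕ → ℚ
walk G s u zero    w = δ s w
walk G s u (suc m) w =
  sumℚ (map (λ v → if v ≡ᵇ u then 0ℚ
                    else (if adj G v w then walk G s u m v ℚ.* invDeg G v else 0ℚ))
            (vertices G))

hitProb : Graph → ℕ → ℕ → ℕ → ℚ
hitProb G s u m = walk G s u m u

partialExp : Graph → ℕ → ℕ → ℕ → ℚ
partialExp G s u zero    = 0ℚ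
partialExp G s u (suc N) = partialExp G s u N ℚ.+ ((+ suc N / 1) ℚ.* hitProb G s u (suc N))

ConvergesTo : (ℕ → ℚ) → ℚ → Set
ConvergesTo f L = ∀ (ε : ℚ) → 0ℚ ℚ.< ε →
  Σ ℕ λ N₀ → ∀ N → N₀ ℕ.≤ N → ℚ.∣ f N ℚ.- L ∣ ℚ.< ε

-- t(G,s,u) = E[T_u] = L, i.e. the series Σ_m m·P(T_u = m) converges to L
HittingTime : Graph → ℕ → ℕ → ℚ → Set
HittingTime G s u L = ConvergesTo (partialExp G s u) L

spine : ℕ → ℕ
spine i = i ∸ 1

ℤtoℚ : ℤ → ℚ
ℤtoℚ z = z / 1

-- If f ≥ 0 vanishes at the target u and f v = 1 + (mean of f over the neighbours of v) at every
-- other vertex, then E_s[T_u] = f s: for the walk killed at u,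
--   Σ_{j ≤ m} j · P(T_u = j) + E_s[f(X_m) + m ; T_u > m] = f s   for every m,
-- and the remainder is at most C · f s / m, because ψ_m = m² + (2m + C) f with C = 2 Σ f is a
-- supermartingale of the killed walk that dominates m · (f + m).
-- On T(n,k,(c_1,…,c_r)) these hitting equations have an explicit solution, quadratic with second
-- difference −2 along every path.  With labels x = i − 1, a = k − 1 and d = c_1 + … + c_r it is
-- (n−1−x)(n−1+x+2d) on the spine from v_k to v_n, f(v_k) + (a−x)(a+x) to the left of v_k, and
-- f(v_k) + (p+1)(2c−1−p) at position p of a pendant path with c vertices; at v_k the equation
-- balances because the first vertex of the j-th pendant path has value f(v_k) + 2c_j − 1.

module Submission where

open import Defs
open import Data.Nat using (ℕ)
open import Data.List using (List; filter)
open import Data.Bool using (T?)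

module NatEmbedding where

  open import Data.Nat as ℕ using (zero; suc)
  import Data.Nat.Properties as ℕP
  import Data.Nat.Coprimality as Coprime
  open import Data.Integer as ℤ using (+_)
  import Data.Integer.Properties as ℤP
  open import Data.Rational as ℚ using (ℚ; mkℚ; 0ℚ; 1ℚ; _/_)
  import Data.Rational.Properties as ℚP
  import Data.Rational.Unnormalised as ℚᵘ
  open import Data.Product using (∃-syntax; _,_)
  open import Data.Empty using (⊥-elim)
  open import Relation.Binary.PropositionalEquality

  opaque
    fromℕ : ℕ → ℚ
    fromℕ n = + n / 1

    fromℕ-def : ∀ n → fromℕ n ≡ + n / 1
    fromℕ-def n = refl

    fromℕ≡mkℚ : ∀ n → fromℕ n ≡ mkℚ (+ n) 0 (Coprime.sym (Coprime.1-coprimeTo n))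
    fromℕ≡mkℚ n = ℚP.↥p/↧p≡p (mkℚ (+ n) 0 (Coprime.sym (Coprime.1-coprimeTo n)))

    fromℕ-0 : fromℕ 0 ≡ 0ℚ
    fromℕ-0 = refl

    fromℕ-+ : ∀ a b → fromℕ (a ℕ.+ b) ≡ fromℕ a ℚ.+ fromℕ b
    fromℕ-+ a b rewrite fromℕ≡mkℚ a | fromℕ≡mkℚ b =
      ℚP./-cong (sym (cong₂ ℤ._+_ (ℤP.*-identityʳ (+ a)) (ℤP.*-identityʳ (+ b)))) refl

    fromℕ-* : ∀ a b → fromℕ (a ℕ.* b) ≡ fromℕ a ℚ.* fromℕ b
    fromℕ-* a b rewrite fromℕ≡mkℚ a | fromℕ≡mkℚ b = ℚP./-cong (ℤP.pos-* a b) refl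

    fromℕ-mono-≤ : ∀ {a b} → a ℕ.≤ b → fromℕ a ℚ.≤ fromℕ b
    fromℕ-mono-≤ {a} {b} a≤b rewrite fromℕ≡mkℚ a | fromℕ≡mkℚ b =
      ℚ.*≤* (subst₂ ℤ._≤_ (sym (ℤP.*-identityʳ (+ a))) (sym (ℤP.*-identityʳ (+ b))) (ℤ.+≤+ a≤b))

    fromℕ-mono-< : ∀ {a b} → a ℕ.< b → fromℕ a ℚ.< fromℕ b
    fromℕ-mono-< {a} {b} a<b rewrite fromℕ≡mkℚ a | fromℕ≡mkℚ b =
      ℚ.*<* (subst₂ ℤ._<_ (sym (ℤP.*-identityʳ (+ a))) (sym (ℤP.*-identityʳ (+ b))) (ℤ.+<+ a<b))

    fromℕ-inverse : ∀ m → (+ 1 / suc m) ℚ.* fromℕ (suc m) ≡ 1ℚ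
    fromℕ-inverse m rewrite fromℕ≡mkℚ (suc m) | ℚP.↥p/↧p≡p (mkℚ (+ 1) m (Coprime.1-coprimeTo _)) =
      ℚP.*-inverseˡ (mkℚ (+ suc m) 0 (Coprime.sym (Coprime.1-coprimeTo (suc m))))

  0≤fromℕ : ∀ n → 0ℚ ℚ.≤ fromℕ n
  0≤fromℕ n = subst (ℚ._≤ fromℕ n) fromℕ-0 (fromℕ-mono-≤ ℕ.z≤n)

  private
    *-fromℕ-denominator : ∀ ε {a} → ℚ.↥ ε ≡ + suc a → ε ℚ.* fromℕ (ℚ.↧ₙ ε) ≡ fromℕ (suc a)
    *-fromℕ-denominator (mkℚ _ b _) {a} refl rewrite fromℕ≡mkℚ (suc b) =
      trans (ℚP.fromℚᵘ-cong {ℚᵘ.mkℚᵘ (+ suc a ℤ.* + suc b) (b ℕ.* 1)} {ℚᵘ.mkℚᵘ (+ suc a) 0}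
                            (ℚᵘ.*≡* cross))
            (sym (fromℕ-def (suc a)))
      where
      cross : (+ suc a ℤ.* + suc b) ℤ.* + 1 ≡ + suc a ℤ.* + suc (b ℕ.* 1)
      cross = trans (ℤP.*-identityʳ _) (cong (λ d → + suc a ℤ.* + d) (sym (ℕP.*-identityʳ (suc b))))

  archimedean : ∀ ε → 0ℚ ℚ.< ε → ∀ K → ∃[ N₀ ] ∀ N → N₀ ℕ.≤ N → fromℕ K ℚ.< fromℕ N ℚ.* ε
  archimedean ε@(mkℚ (+ zero) _ _)   0<ε K = ⊥-elim (ℚP.<-irrefl (sym (ℚP.↥p≡0⇒p≡0 ε refl)) 0<ε)
  archimedean ε@(mkℚ ℤ.-[1+ _ ] _ _) 0<ε K = ⊥-elim (ℚP.<-asym 0<ε (ℚP.negative⁻¹ ε))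
  archimedean ε@(mkℚ (+ suc a) b _)  _   K = suc (K ℕ.* suc b) , λ N N₀≤N →
    ℚP.*-cancelʳ-<-nonNeg den {{ℚ.nonNegative (0≤fromℕ (suc b))}} (begin-strict
      fromℕ K ℚ.* den             ≡⟨ fromℕ-* K (suc b) ⟨
      fromℕ (K ℕ.* suc b)         <⟨ fromℕ-mono-< (ℕP.<-≤-trans N₀≤N (ℕP.m≤m*n N (suc a))) ⟩
      fromℕ (N ℕ.* suc a)         ≡⟨ fromℕ-* N (suc a) ⟩
      fromℕ N ℚ.* fromℕ (suc a)   ≡⟨ cong (fromℕ N ℚ.*_) (*-fromℕ-denominator ε refl) ⟨
      fromℕ N ℚ.* (ε ℚ.* den)     ≡⟨ ℚP.*-assoc (fromℕ N) ε den ⟨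
      fromℕ N ℚ.* ε ℚ.* den       ∎)
    where
    open ℚP.≤-Reasoning
    den : ℚ
    den = fromℕ (suc b)

module NatTests where

  open import Data.Nat using (_≡ᵇ_; _<ᵇ_; _≤_; _<_)
  import Data.Nat.Properties as ℕP
  open import Data.Bool using (true; false)
  open import Relation.Nullary.Decidable using (dec-true; dec-false)
  open import Relation.Binary.PropositionalEquality using (_≡_; _≢_)

  ≡ᵇ-true : ∀ {x y} → x ≡ y → (x ≡ᵇ y) ≡ true
  ≡ᵇ-true {x} {y} = dec-true (x ℕP.≟ y)

  ≡ᵇ-false : ∀ {x y} → x ≢ y → (x ≡ᵇ y) ≡ false
  ≡ᵇ-false {x} {y} = dec-false (x ℕP.≟ y)

  <ᵇ-true : ∀ {x y} → x < y → (x <ᵇ y) ≡ true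
  <ᵇ-true {x} {y} = dec-true (x ℕP.<? y)

  <ᵇ-false : ∀ {x y} → y ≤ x → (x <ᵇ y) ≡ false
  <ᵇ-false {x} {y} y≤x = dec-false (x ℕP.<? y) (ℕP.≤⇒≯ y≤x)

module ListSums where

  open import Data.Nat using (_≡ᵇ_)
  open import Data.Rational as ℚ using (ℚ; 0ℚ; _+_; _*_; _≤_)
  import Data.Rational.Properties as ℚP
  open import Data.List using ([]; _∷_; map)
  open import Data.Nat.ListAction using (sum)
  open import Data.Bool using (Bool; true; false; if_then_else_)
  open import Data.List.Membership.Propositional using (_∈_)
  open import Data.List.Relation.Unary.Any using (here; there)
  open import Data.List.Relation.Unary.All as All using ()
  open import Data.List.Relation.Unary.Unique.Propositional using (Unique; _∷_)
  open import Relation.Binary.PropositionalEquality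
  open import Algebra.Bundles using (module CommutativeMonoid)
  open import Algebra.Properties.CommutativeSemigroup
    (CommutativeMonoid.commutativeSemigroup ℚP.+-0-commutativeMonoid) using (interchange)
  open NatEmbedding
  open NatTests

  ∑ : List ℕ → (ℕ → ℚ) → ℚ
  ∑ L g = sumℚ (map g L)

  ∑-cong : ∀ L {g h} → (∀ {x} → x ∈ L → g x ≡ h x) → ∑ L g ≡ ∑ L h
  ∑-cong []      g≡h = refl
  ∑-cong (x ∷ L) g≡h = cong₂ _+_ (g≡h (here refl)) (∑-cong L (λ x∈L → g≡h (there x∈L)))

  ∑-mono : ∀ L {g h} → (∀ {x} → x ∈ L → g x ≤ h x) → ∑ L g ≤ ∑ L h
  ∑-mono []      g≤h = ℚP.≤-refl
  ∑-mono (x ∷ L) g≤h = ℚP.+-mono-≤ (g≤h (here refl)) (∑-mono L (λ x∈L → g≤h (there x∈L)))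

  ∑-zero : ∀ L {g} → (∀ {x} → x ∈ L → g x ≡ 0ℚ) → ∑ L g ≡ 0ℚ
  ∑-zero []      g≡0 = refl
  ∑-zero (x ∷ L) g≡0 = trans (cong₂ _+_ (g≡0 (here refl)) (∑-zero L (λ x∈L → g≡0 (there x∈L)))) (ℚP.+-identityˡ 0ℚ)

  ∑-nonneg : ∀ L {g} → (∀ {x} → x ∈ L → 0ℚ ≤ g x) → 0ℚ ≤ ∑ L g
  ∑-nonneg L 0≤g = subst (_≤ ∑ L _) (∑-zero L (λ _ → refl)) (∑-mono L 0≤g)

  ∑-+ : ∀ L g h → ∑ L (λ x → g x + h x) ≡ ∑ L g + ∑ L h
  ∑-+ []      g h = refl
  ∑-+ (x ∷ L) g h = trans (cong (g x + h x +_) (∑-+ L g h)) (interchange (g x) (h x) (∑ L g) (∑ L h))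

  ∑-*ˡ : ∀ L c g → c * ∑ L g ≡ ∑ L (λ x → c * g x)
  ∑-*ˡ []      c g = ℚP.*-zeroʳ c
  ∑-*ˡ (x ∷ L) c g = trans (ℚP.*-distribˡ-+ c (g x) (∑ L g)) (cong (c * g x +_) (∑-*ˡ L c g))

  ∑-*ʳ : ∀ L c g → ∑ L g * c ≡ ∑ L (λ x → g x * c)
  ∑-*ʳ L c g = trans (ℚP.*-comm (∑ L g) c) (trans (∑-*ˡ L c g) (∑-cong L (λ {x} _ → ℚP.*-comm c (g x))))

  ∑-swap : ∀ L M (k : ℕ → ℕ → ℚ) → ∑ L (λ x → ∑ M (k x)) ≡ ∑ M (λ y → ∑ L (λ x → k x y))
  ∑-swap []      M k = sym (∑-zero M (λ _ → refl))
  ∑-swap (x ∷ L) M k =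
    trans (cong (∑ M (k x) +_) (∑-swap L M k)) (sym (∑-+ M (k x) (λ y → ∑ L (λ x → k x y))))

  ∑-filter : ∀ L (b : ℕ → Bool) g → ∑ L (λ x → if b x then g x else 0ℚ) ≡ ∑ (filter (λ x → T? (b x)) L) g
  ∑-filter []      b g = refl
  ∑-filter (x ∷ L) b g with b x
  ... | true  = cong (g x +_) (∑-filter L b g)
  ... | false = trans (ℚP.+-identityˡ _) (∑-filter L b g)

  ∑-pick : ∀ {L u} (g : ℕ → ℚ) → Unique L → u ∈ L → ∑ L (λ x → if x ≡ᵇ u then g x else 0ℚ) ≡ g u
  ∑-pick {x ∷ L} g (x∉L ∷ _) (here refl) rewrite ≡ᵇ-true {x} refl =
    trans (cong (g x +_) (∑-zero L others)) (ℚP.+-identityʳ (g x))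
    where
    others : ∀ {y} → y ∈ L → (if y ≡ᵇ x then g y else 0ℚ) ≡ 0ℚ
    others {y} y∈L = cong (if_then g y else 0ℚ) (≡ᵇ-false (≢-sym (All.lookup x∉L y∈L)))
  ∑-pick {x ∷ L} g (x∉L ∷ unique) (there u∈L) rewrite ≡ᵇ-false (All.lookup x∉L u∈L) =
    trans (ℚP.+-identityˡ _) (∑-pick g unique u∈L)

  fromℕ-sum : ∀ L g → fromℕ (sum (map g L)) ≡ ∑ L (λ x → fromℕ (g x))
  fromℕ-sum []      g = fromℕ-0
  fromℕ-sum (x ∷ L) g = trans (fromℕ-+ (g x) _) (cong (fromℕ (g x) +_) (fromℕ-sum L g))

neighbours : Graph → ℕ → List ℕ
neighbours G v = filter (λ w → T? (adj G v w)) (vertices G)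

module NatArithmetic where

  open import Data.Nat using (suc; z≤n; s≤s; _+_; _*_; _∸_; _≤_; _<_)
  import Data.Nat.Properties as ℕP
  open import Data.Nat.Tactic.RingSolver using (solve-∀)
  open import Data.List using ([]; _∷_; map; length)
  open import Data.Nat.ListAction using (sum)
  open import Data.List.Membership.Propositional using (_∈_)
  open import Data.List.Relation.Unary.Any using (here; there)
  open import Data.Product using (_×_; _,_)
  open import Relation.Binary.PropositionalEquality

  m+n≡o⇒m≤o : ∀ {x r m} → x + r ≡ m → x ≤ m
  m+n≡o⇒m≤o {x} {r} refl = ℕP.m≤m+n x r

  m+[1+n]≡o⇒m<o : ∀ {x r m} → x + suc r ≡ m → x < m
  m+[1+n]≡o⇒m<o {x} refl = ℕP.m<m+n x (s≤s z≤n)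

  m+n≡o⇒o∸m≡n : ∀ {x r m} → x + r ≡ m → m ∸ x ≡ r
  m+n≡o⇒o∸m≡n {x} {r} refl = ℕP.m+n∸m≡n x r

  m+[1+n]≡o⇒o∸1∸m≡n : ∀ {x r m} → x + suc r ≡ m → m ∸ 1 ∸ x ≡ r
  m+[1+n]≡o⇒o∸1∸m≡n {x} {r} {m} x+r+1≡m =
    trans (ℕP.∸-+-assoc m 1 x) (m+n≡o⇒o∸m≡n (trans (sym (ℕP.+-suc x r)) x+r+1≡m))

  shift₂ : ∀ {y b m} → suc (suc y) + b ≡ m → suc y + suc b ≡ m × y + suc (suc b) ≡ m
  shift₂ {y} {b} {m} y+2+b≡m = y+1+b+1≡m , trans (ℕP.+-suc y (suc b)) y+1+b+1≡m
    where
    y+1+b+1≡m : suc y + suc b ≡ m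
    y+1+b+1≡m = trans (ℕP.+-suc (suc y) b) y+2+b≡m

  ≢pred⇒suc< : ∀ {x m} → x < m → x ≢ m ∸ 1 → suc x < m
  ≢pred⇒suc< {x} {suc m} (s≤s x≤m) x≢m = s≤s (ℕP.≤∧≢⇒< x≤m x≢m)

  ≤pred⇒< : ∀ {m n} → suc m ≤ n ∸ 1 → suc m < n
  ≤pred⇒< {m} {suc n} m+1≤n = s≤s m+1≤n

  ∈⇒≤sum : ∀ (g : ℕ → ℕ) {L x} → x ∈ L → g x ≤ sum (map g L)
  ∈⇒≤sum g {y ∷ L} (here refl)  = ℕP.m≤m+n (g y) _
  ∈⇒≤sum g {y ∷ L} (there x∈L) = ℕP.≤-trans (∈⇒≤sum g x∈L) (ℕP.m≤n+m _ (g y))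

  sum-map-+ʳ : ∀ (g : ℕ → ℕ) c L → sum (map (λ x → g x + c) L) ≡ sum (map g L) + length L * c
  sum-map-+ʳ g c []      = refl
  sum-map-+ʳ g c (x ∷ L) = trans (cong (g x + c +_) (sum-map-+ʳ g c L)) (shuffle (g x) c (sum (map g L)) (length L))
    where
    shuffle : ∀ y c S l → y + c + (S + l * c) ≡ y + S + (c + l * c)
    shuffle = solve-∀

  sum-map-affine : ∀ (g : ℕ → ℕ) a b L → sum (map (λ x → a + b * g x) L) ≡ length L * a + b * sum (map g L)
  sum-map-affine g a b []      = sym (ℕP.*-zeroʳ b)
  sum-map-affine g a b (x ∷ L) =
    trans (cong (a + b * g x +_) (sum-map-affine g a b L)) (shuffle a b (g x) (length L) _)
    where
    shuffle : ∀ a b y l S → a + b * y + (l * a + b * S) ≡ (a + l * a) + b * (y + S)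
    shuffle = solve-∀

  harmonic-shift : ∀ {D S φ} m → φ * D ≡ D + S → S + D * suc m ≡ (φ + m) * D
  harmonic-shift {D} {S} {φ} m φD≡D+S = begin
    S + D * suc m    ≡⟨ regroup S D m ⟩
    D + S + D * m    ≡⟨ cong (_+ D * m) φD≡D+S ⟨
    φ * D + D * m    ≡⟨ factor φ D m ⟩
    (φ + m) * D      ∎
    where
    open ≡-Reasoning
    regroup : ∀ S D m → S + D * suc m ≡ D + S + D * m
    regroup = solve-∀
    factor : ∀ φ D m → φ * D + D * m ≡ (φ + m) * D
    factor = solve-∀

  supermartingale-inequality : ∀ {D S φ F} m → φ * D ≡ D + S → φ ≤ F →
    D * (suc m * suc m) + (2 * suc m + 2 * F) * S ≤ (m * m + (2 * m + 2 * F) * φ) * D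
  supermartingale-inequality {D} {S} {φ} m φD≡D+S φ≤F with ℕP.m≤n⇒∃[o]m+o≡n φ≤F
  ... | e , refl = ℕP.+-cancelʳ-≤ (b * D) _ _ (begin
    D * (suc m * suc m) + b * S + b * D                   ≡⟨ regroup D (suc m * suc m) b S ⟩
    D * (suc m * suc m) + b * (D + S)                     ≡⟨ cong (λ t → D * (suc m * suc m) + b * t) φD≡D+S ⟨
    D * (suc m * suc m) + b * (φ * D)                     ≤⟨ ℕP.m≤m+n _ (D * (1 + 2 * e)) ⟩
    D * (suc m * suc m) + b * (φ * D) + D * (1 + 2 * e)   ≡⟨ expand D m φ e ⟩
    (m * m + (2 * m + 2 * (φ + e)) * φ) * D + b * D       ∎)
    where
    open ℕP.≤-Reasoning
    b : ℕ
    b = 2 * suc m + 2 * (φ + e)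
    regroup : ∀ D q b S → D * q + b * S + b * D ≡ D * q + b * (D + S)
    regroup = solve-∀
    expand : ∀ D m φ e → D * (suc m * suc m) + (2 * suc m + 2 * (φ + e)) * (φ * D) + D * (1 + 2 * e)
                       ≡ (m * m + (2 * m + 2 * (φ + e)) * φ) * D + (2 * suc m + 2 * (φ + e)) * D
    expand = solve-∀

  supermartingale-dominates : ∀ m φ C → m * (φ + m) ≤ m * m + (2 * m + C) * φ
  supermartingale-dominates m φ C = begin
    m * (φ + m)                     ≤⟨ ℕP.m≤m+n _ (m * φ + C * φ) ⟩
    m * (φ + m) + (m * φ + C * φ)   ≡⟨ expand m φ C ⟩
    m * m + (2 * m + C) * φ         ∎
    where
    open ℕP.≤-Reasoning
    expand : ∀ m φ C → m * (φ + m) + (m * φ + C * φ) ≡ m * m + (2 * m + C) * φ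
    expand = solve-∀

module HittingTimes (G : Graph) (u : ℕ) where

  open import Data.Nat as ℕ using (zero; suc; _≡ᵇ_; NonZero)
  import Data.Nat.Properties as ℕP
  import Data.Integer as ℤ
  open import Data.Rational as ℚ using (ℚ; 0ℚ; 1ℚ; _+_; _*_; _-_; -_; ∣_∣; _≤_; _/_)
  import Data.Rational.Properties as ℚP
  open import Data.List using (map)
  open import Data.Nat.ListAction using (sum)
  open import Data.Bool using (true; false; if_then_else_)
  open import Data.Product using (_,_)
  open import Data.List.Membership.Propositional.Properties using (∈-upTo⁺; ∈-upTo⁻)
  open import Data.List.Relation.Unary.Unique.Propositional.Properties using (upTo⁺)
  open import Relation.Nullary using (yes; no)
  open import Relation.Nullary.Decidable using (dec⇒maybe)
  open import Relation.Binary.PropositionalEquality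
  open import Level using (0ℓ)
  import Tactic.RingSolver as ℚ-Solver
  open import Tactic.RingSolver.Core.AlmostCommutativeRing using (AlmostCommutativeRing; fromCommutativeRing)
  open import Algebra.Bundles using (module CommutativeMonoid)
  open import Algebra.Properties.CommutativeSemigroup
    (CommutativeMonoid.commutativeSemigroup ℚP.*-1-commutativeMonoid) using (x∙yz≈y∙xz)
  open NatEmbedding
  open NatTests
  open ListSums
  open NatArithmetic

  ℚ-ring : AlmostCommutativeRing 0ℓ 0ℓ
  ℚ-ring = fromCommutativeRing ℚP.+-*-commutativeRing (λ x → dec⇒maybe (0ℚ ℚP.≟ x))

  record SolvesHittingEquations (f : ℕ → ℕ) : Set where
    field
      at-target   : f u ≡ 0
      nonisolated : ∀ {v} → v ℕ.< size G → v ≢ u → NonZero (degree G v)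
      harmonic    : ∀ {v} → v ℕ.< size G → v ≢ u →
                    f v ℕ.* degree G v ≡ degree G v ℕ.+ sum (map f (neighbours G v))

  killed : (ℕ → ℚ) → ℕ → ℚ
  killed g x = if x ≡ᵇ u then 0ℚ else g x

  average : (ℕ → ℚ) → ℕ → ℚ
  average g v = invDeg G v * ∑ (neighbours G v) g

  *-nonneg : ∀ {p q} → 0ℚ ≤ p → 0ℚ ≤ q → 0ℚ ≤ p * q
  *-nonneg {p} {q} 0≤p 0≤q =
    ℚP.nonNegative⁻¹ _ {{ℚP.nonNeg*nonNeg⇒nonNeg p {{ℚ.nonNegative 0≤p}} q {{ℚ.nonNegative 0≤q}}}}

  p≤p+q : ∀ {p q} → 0ℚ ≤ q → p ≤ p + q
  p≤p+q {p} 0≤q = ℚP.≤-trans (ℚP.≤-reflexive (sym (ℚP.+-identityʳ p))) (ℚP.+-monoʳ-≤ p 0≤q)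

  invDeg-nonneg : ∀ v → 0ℚ ≤ invDeg G v
  invDeg-nonneg v with degree G v
  ... | zero  = ℚP.≤-refl
  ... | suc m = ℚP.nonNegative⁻¹ _ {{ℚP.normalize-nonNeg 1 (suc m)}}

  invDeg*fromℕ-cancel : ∀ v h → NonZero (degree G v) → invDeg G v * fromℕ (h ℕ.* degree G v) ≡ fromℕ h
  invDeg*fromℕ-cancel v h nz = begin
    invDeg G v * fromℕ (h ℕ.* degree G v)         ≡⟨ cong (invDeg G v *_) (fromℕ-* h (degree G v)) ⟩
    invDeg G v * (fromℕ h * fromℕ (degree G v))   ≡⟨ x∙yz≈y∙xz (invDeg G v) (fromℕ h) _ ⟩
    fromℕ h * (invDeg G v * fromℕ (degree G v))   ≡⟨ cong (fromℕ h *_) (invDeg*degree nz) ⟩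
    fromℕ h * 1ℚ                                  ≡⟨ ℚP.*-identityʳ (fromℕ h) ⟩
    fromℕ h                                       ∎
    where
    open ≡-Reasoning
    invDeg*degree : NonZero (degree G v) → invDeg G v * fromℕ (degree G v) ≡ 1ℚ
    invDeg*degree _ with degree G v
    ... | suc m = fromℕ-inverse m

  average-fromℕ : ∀ g v → average (λ x → fromℕ (g x)) v ≡ invDeg G v * fromℕ (sum (map g (neighbours G v)))
  average-fromℕ g v = cong (invDeg G v *_) (sym (fromℕ-sum (neighbours G v) g))

  average-fromℕ-≡ : ∀ {g v h} → NonZero (degree G v) → sum (map g (neighbours G v)) ≡ h ℕ.* degree G v →
                    average (λ x → fromℕ (g x)) v ≡ fromℕ h
  average-fromℕ-≡ {g} {v} {h} nz sum≡ =
    trans (average-fromℕ g v) (trans (cong (λ n → invDeg G v * fromℕ n) sum≡) (invDeg*fromℕ-cancel v h nz))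

  average-fromℕ-≤ : ∀ {g v h} → NonZero (degree G v) → sum (map g (neighbours G v)) ℕ.≤ h ℕ.* degree G v →
                    average (λ x → fromℕ (g x)) v ≤ fromℕ h
  average-fromℕ-≤ {g} {v} {h} nz sum≤ = begin
    average (λ x → fromℕ (g x)) v                      ≡⟨ average-fromℕ g v ⟩
    invDeg G v * fromℕ (sum (map g (neighbours G v)))  ≤⟨ ℚP.*-monoˡ-≤-nonNeg (invDeg G v)
                                                            {{ℚ.nonNegative (invDeg-nonneg v)}} (fromℕ-mono-≤ sum≤) ⟩
    invDeg G v * fromℕ (h ℕ.* degree G v)              ≡⟨ invDeg*fromℕ-cancel v h nz ⟩
    fromℕ h                                            ∎
    where open ℚP.≤-Reasoning

  killed-cong : ∀ {g h} → (∀ {v} → v ℕ.< size G → v ≢ u → g v ≡ h v) →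
                ∀ {x} → x ℕ.< size G → killed g x ≡ killed h x
  killed-cong g≡h {x} x<size with x ℕP.≟ u
  ... | yes refl rewrite ≡ᵇ-true {x} refl = refl
  ... | no x≢u   rewrite ≡ᵇ-false x≢u     = g≡h x<size x≢u

  killed-mono : ∀ {g h} → (∀ {v} → v ℕ.< size G → v ≢ u → g v ≤ h v) →
                ∀ {x} → x ℕ.< size G → killed g x ≤ killed h x
  killed-mono g≤h {x} x<size with x ℕP.≟ u
  ... | yes refl rewrite ≡ᵇ-true {x} refl = ℚP.≤-refl
  ... | no x≢u   rewrite ≡ᵇ-false x≢u     = g≤h x<size x≢u

  killed-fixes : ∀ {g} → g u ≡ 0ℚ → ∀ x → killed g x ≡ g x
  killed-fixes gu≡0 x with x ℕP.≟ u
  ... | yes refl rewrite ≡ᵇ-true {x} refl = sym gu≡0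
  ... | no x≢u   rewrite ≡ᵇ-false x≢u     = refl

  killed-≤ : ∀ {g x} → 0ℚ ≤ g x → killed g x ≤ g x
  killed-≤ {g} {x} 0≤gx with x ≡ᵇ u
  ... | true  = 0≤gx
  ... | false = ℚP.≤-refl

  killed-nonneg : ∀ {g x} → 0ℚ ≤ g x → 0ℚ ≤ killed g x
  killed-nonneg {g} {x} 0≤gx with x ≡ᵇ u
  ... | true  = ℚP.≤-refl
  ... | false = 0≤gx

  *-killed : ∀ c g x → c * killed g x ≡ killed (λ y → c * g y) x
  *-killed c g x with x ≡ᵇ u
  ... | true  = ℚP.*-zeroʳ c
  ... | false = refl

  module _ (s : ℕ) where

    V : List ℕ
    V = vertices G

    -- 𝔼 m g = E_s[g(X_m) ; X_j ≢ u for j < m], walk G s u being the walk killed on reaching u.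
    𝔼 : ℕ → (ℕ → ℚ) → ℚ
    𝔼 m g = ∑ V (λ x → walk G s u m x * g x)

    walk-nonneg : ∀ m x → 0ℚ ≤ walk G s u m x
    walk-nonneg zero x with s ≡ᵇ x
    ... | true  = ℚP.nonNegative⁻¹ 1ℚ
    ... | false = ℚP.≤-refl
    walk-nonneg (suc m) x = ∑-nonneg V (λ {v} _ → step-nonneg v)
      where
      step-nonneg : ∀ v → 0ℚ ≤ (if v ≡ᵇ u then 0ℚ else (if adj G v x then walk G s u m v * invDeg G v else 0ℚ))
      step-nonneg v with v ≡ᵇ u | adj G v x
      ... | true  | _     = ℚP.≤-refl
      ... | false | true  = *-nonneg (walk-nonneg m v) (invDeg-nonneg v)
      ... | false | false = ℚP.≤-refl

    𝔼-cong : ∀ m {g h} → (∀ {x} → x ℕ.< size G → g x ≡ h x) → 𝔼 m g ≡ 𝔼 m h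
    𝔼-cong m g≡h = ∑-cong V (λ {x} x∈V → cong (walk G s u m x *_) (g≡h (∈-upTo⁻ x∈V)))

    𝔼-mono : ∀ m {g h} → (∀ {x} → x ℕ.< size G → g x ≤ h x) → 𝔼 m g ≤ 𝔼 m h
    𝔼-mono m g≤h = ∑-mono V (λ {x} x∈V →
      ℚP.*-monoˡ-≤-nonNeg (walk G s u m x) {{ℚ.nonNegative (walk-nonneg m x)}} (g≤h (∈-upTo⁻ x∈V)))

    𝔼-nonneg : ∀ m {g} → (∀ {x} → x ℕ.< size G → 0ℚ ≤ g x) → 0ℚ ≤ 𝔼 m g
    𝔼-nonneg m 0≤g = ∑-nonneg V (λ {x} x∈V → *-nonneg (walk-nonneg m x) (0≤g (∈-upTo⁻ x∈V)))

    𝔼-*ˡ : ∀ m c g → c * 𝔼 m g ≡ 𝔼 m (λ x → c * g x)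
    𝔼-*ˡ m c g = trans (∑-*ˡ V c _) (∑-cong V (λ {x} _ → x∙yz≈y∙xz c (walk G s u m x) (g x)))

    𝔼-zero : s ℕ.< size G → ∀ g → 𝔼 0 g ≡ g s
    𝔼-zero s<size g = trans (∑-cong V (λ {x} _ → δ-* x)) (∑-pick g (upTo⁺ (size G)) (∈-upTo⁺ s<size))
      where
      δ-* : ∀ x → δ s x * g x ≡ (if x ≡ᵇ s then g x else 0ℚ)
      δ-* x with x ℕP.≟ s
      ... | yes refl rewrite ≡ᵇ-true {x} refl                   = ℚP.*-identityˡ (g x)
      ... | no x≢s   rewrite ≡ᵇ-false x≢s | ≡ᵇ-false (≢-sym x≢s) = ℚP.*-zeroˡ (g x)

    𝔼-killed : u ℕ.< size G → ∀ m g → 𝔼 m g ≡ 𝔼 m (killed g) + walk G s u m u * g u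
    𝔼-killed u<size m g = begin
      ∑ V (λ x → P x * g x)                                     ≡⟨ ∑-cong V (λ {x} _ → split x) ⟩
      ∑ V (λ x → P x * killed g x + at-u x)                     ≡⟨ ∑-+ V _ at-u ⟩
      𝔼 m (killed g) + ∑ V at-u                                 ≡⟨ cong (𝔼 m (killed g) +_) picked ⟩
      𝔼 m (killed g) + P u * g u                                ∎
      where
      open ≡-Reasoning
      P : ℕ → ℚ
      P = walk G s u m
      at-u : ℕ → ℚ
      at-u x = if x ≡ᵇ u then P x * g x else 0ℚ
      split : ∀ x → P x * g x ≡ P x * killed g x + at-u x
      split x with x ≡ᵇ u
      ... | true  = sym (trans (cong (_+ P x * g x) (ℚP.*-zeroʳ (P x))) (ℚP.+-identityˡ _))
      ... | false = sym (ℚP.+-identityʳ _)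
      picked : ∑ V at-u ≡ P u * g u
      picked = ∑-pick (λ x → P x * g x) (upTo⁺ (size G)) (∈-upTo⁺ u<size)

    𝔼-suc : ∀ m g → 𝔼 (suc m) g ≡ 𝔼 m (killed (average g))
    𝔼-suc m g = begin
      ∑ V (λ w → ∑ V (λ v → step v w) * g w)    ≡⟨ ∑-cong V (λ {w} _ → ∑-*ʳ V (g w) (λ v → step v w)) ⟩
      ∑ V (λ w → ∑ V (λ v → step v w * g w))    ≡⟨ ∑-swap V V (λ w v → step v w * g w) ⟩
      ∑ V (λ v → ∑ V (λ w → step v w * g w))    ≡⟨ ∑-cong V (λ {v} _ → from v) ⟩
      𝔼 m (killed (average g))                  ∎
      where
      open ≡-Reasoning
      P : ℕ → ℚ
      P = walk G s u m
      step : ℕ → ℕ → ℚ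
      step v w = if v ≡ᵇ u then 0ℚ else (if adj G v w then P v * invDeg G v else 0ℚ)
      if-*ʳ : ∀ b {c} y → (if b then c else 0ℚ) * y ≡ (if b then c * y else 0ℚ)
      if-*ʳ true  y = refl
      if-*ʳ false y = ℚP.*-zeroˡ y
      from : ∀ v → ∑ V (λ w → step v w * g w) ≡ P v * killed (average g) v
      from v with v ≡ᵇ u
      ... | true  = trans (∑-zero V (λ {w} _ → ℚP.*-zeroˡ (g w))) (sym (ℚP.*-zeroʳ (P v)))
      ... | false = begin
        ∑ V (λ w → (if adj G v w then c else 0ℚ) * g w)  ≡⟨ ∑-cong V (λ {w} _ → if-*ʳ (adj G v w) (g w)) ⟩
        ∑ V (λ w → if adj G v w then c * g w else 0ℚ)   ≡⟨ ∑-filter V (adj G v) _ ⟩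
        ∑ (neighbours G v) (λ w → c * g w)              ≡⟨ ∑-*ˡ (neighbours G v) c g ⟨
        c * ∑ (neighbours G v) g                        ≡⟨ ℚP.*-assoc (P v) (invDeg G v) _ ⟩
        P v * average g v                               ∎
        where c = P v * invDeg G v

    𝔼-transition : u ℕ.< size G → ∀ m g →
                   𝔼 (suc m) (killed g) + walk G s u (suc m) u * g u ≡ 𝔼 m (killed (average g))
    𝔼-transition u<size m g = trans (sym (𝔼-killed u<size (suc m) g)) (𝔼-suc m g)

    module _ {f : ℕ → ℕ} (solves : SolvesHittingEquations f) (u<size : u ℕ.< size G) (s<size : s ℕ.< size G) where

      open SolvesHittingEquations solves

      shifted : ℕ → ℕ → ℚ
      shifted m x = fromℕ (f x ℕ.+ m)

      tail : ℕ → ℚ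
      tail m = 𝔼 m (killed (shifted m))

      tail-nonneg : ∀ m → 0ℚ ≤ tail m
      tail-nonneg m = 𝔼-nonneg m (λ {x} _ → killed-nonneg {shifted m} {x} (0≤fromℕ (f x ℕ.+ m)))

      tail-step : ∀ m → tail (suc m) + walk G s u (suc m) u * fromℕ (suc m) ≡ tail m
      tail-step m = begin
        tail (suc m) + W * fromℕ (suc m)           ≡⟨ cong (λ φ → tail (suc m) + W * fromℕ (φ ℕ.+ suc m)) at-target ⟨
        tail (suc m) + W * shifted (suc m) u       ≡⟨ 𝔼-transition u<size m (shifted (suc m)) ⟩
        𝔼 m (killed (average (shifted (suc m))))   ≡⟨ 𝔼-cong m (killed-cong averaged) ⟩
        tail m                                     ∎
        where
        open ≡-Reasoning
        W : ℚ
        W = walk G s u (suc m) u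
        averaged : ∀ {v} → v ℕ.< size G → v ≢ u → average (shifted (suc m)) v ≡ shifted m v
        averaged {v} v<size v≢u = average-fromℕ-≡ (nonisolated v<size v≢u)
          (trans (sum-map-+ʳ f (suc m) (neighbours G v))
                 (harmonic-shift {degree G v} {sum (map f (neighbours G v))} {f v} m (harmonic v<size v≢u)))

      partialExp+tail : ∀ m → partialExp G s u m + tail m ≡ fromℕ (f s)
      partialExp+tail zero = begin
        0ℚ + tail 0                   ≡⟨ ℚP.+-identityˡ (tail 0) ⟩
        𝔼 0 (killed (shifted 0))      ≡⟨ 𝔼-zero s<size _ ⟩
        killed (shifted 0) s          ≡⟨ killed-fixes (trans (cong (λ φ → fromℕ (φ ℕ.+ 0)) at-target) fromℕ-0) s ⟩
        fromℕ (f s ℕ.+ 0)             ≡⟨ cong fromℕ (ℕP.+-identityʳ (f s)) ⟩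
        fromℕ (f s)                   ∎
        where open ≡-Reasoning
      partialExp+tail (suc m) = begin
        E + (ℤ.+ suc m) / 1 * W + tail (suc m)   ≡⟨ cong (λ q → E + q * W + tail (suc m)) (fromℕ-def (suc m)) ⟨
        E + fromℕ (suc m) * W + tail (suc m)     ≡⟨ regroup E (fromℕ (suc m)) W (tail (suc m)) ⟩
        E + (tail (suc m) + W * fromℕ (suc m))   ≡⟨ cong (E +_) (tail-step m) ⟩
        E + tail m                               ≡⟨ partialExp+tail m ⟩
        fromℕ (f s)                              ∎
        where
        open ≡-Reasoning
        E W : ℚ
        E = partialExp G s u m
        W = walk G s u (suc m) u
        regroup : ∀ a b c d → a + b * c + d ≡ a + (d + c * b)
        regroup = ℚ-Solver.solve-∀ ℚ-ring

      C : ℕ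
      C = 2 ℕ.* sum (map f V)

      ψ : ℕ → ℕ → ℕ
      ψ m x = m ℕ.* m ℕ.+ (2 ℕ.* m ℕ.+ C) ℕ.* f x

      ψ̂ : ℕ → ℕ → ℚ
      ψ̂ m x = fromℕ (ψ m x)

      ψ-antitone : ∀ m → 𝔼 (suc m) (killed (ψ̂ (suc m))) ≤ 𝔼 m (killed (ψ̂ m))
      ψ-antitone m = begin
        𝔼 (suc m) (killed (ψ̂ (suc m)))                    ≤⟨ p≤p+q (*-nonneg (walk-nonneg (suc m) u) (0≤fromℕ _)) ⟩
        𝔼 (suc m) (killed (ψ̂ (suc m))) + W * ψ̂ (suc m) u  ≡⟨ 𝔼-transition u<size m (ψ̂ (suc m)) ⟩
        𝔼 m (killed (average (ψ̂ (suc m))))                ≤⟨ 𝔼-mono m (killed-mono averaged) ⟩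
        𝔼 m (killed (ψ̂ m))                                ∎
        where
        open ℚP.≤-Reasoning
        W : ℚ
        W = walk G s u (suc m) u
        averaged : ∀ {v} → v ℕ.< size G → v ≢ u → average (ψ̂ (suc m)) v ≤ ψ̂ m v
        averaged {v} v<size v≢u = average-fromℕ-≤ (nonisolated v<size v≢u)
          (ℕP.≤-trans (ℕP.≤-reflexive (sum-map-affine f (suc m ℕ.* suc m) (2 ℕ.* suc m ℕ.+ C) (neighbours G v)))
                      (supermartingale-inequality m (harmonic v<size v≢u) (∈⇒≤sum f (∈-upTo⁺ v<size))))

      ψ-bound : ∀ m → 𝔼 m (killed (ψ̂ m)) ≤ fromℕ (C ℕ.* f s)
      ψ-bound zero    = ℚP.≤-trans (ℚP.≤-reflexive (𝔼-zero s<size _)) (killed-≤ {ψ̂ 0} {s} (0≤fromℕ _))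
      ψ-bound (suc m) = ℚP.≤-trans (ψ-antitone m) (ψ-bound m)

      tail-bound : ∀ m → fromℕ m * tail m ≤ fromℕ (C ℕ.* f s)
      tail-bound m = begin
        fromℕ m * tail m                             ≡⟨ 𝔼-*ˡ m (fromℕ m) _ ⟩
        𝔼 m (λ x → fromℕ m * killed (shifted m) x)   ≡⟨ 𝔼-cong m (λ {x} _ → *-killed (fromℕ m) (shifted m) x) ⟩
        𝔼 m (killed (λ x → fromℕ m * shifted m x))   ≤⟨ 𝔼-mono m (killed-mono dominated) ⟩
        𝔼 m (killed (ψ̂ m))                           ≤⟨ ψ-bound m ⟩
        fromℕ (C ℕ.* f s)                            ∎
        where
        open ℚP.≤-Reasoning
        dominated : ∀ {x} → x ℕ.< size G → x ≢ u → fromℕ m * shifted m x ≤ ψ̂ m x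
        dominated {x} _ _ = ℚP.≤-trans (ℚP.≤-reflexive (sym (fromℕ-* m (f x ℕ.+ m))))
                                       (fromℕ-mono-≤ (supermartingale-dominates m (f x) C))

      hittingTime : HittingTime G s u (fromℕ (f s))
      hittingTime ε 0<ε with archimedean ε 0<ε (C ℕ.* f s)
      ... | N₀ , K<Nε = N₀ , λ N N₀≤N → begin-strict
        ∣ E N - fromℕ (f s) ∣             ≡⟨ cong (λ z → ∣ E N - z ∣) (partialExp+tail N) ⟨
        ∣ E N - (E N + tail N) ∣          ≡⟨ cong ∣_∣ (cancel (E N) (tail N)) ⟩
        ∣ - tail N ∣                      ≡⟨ ℚP.∣-p∣≡∣p∣ (tail N) ⟩
        ∣ tail N ∣                        ≡⟨ ℚP.0≤p⇒∣p∣≡p (tail-nonneg N) ⟩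
        tail N                            <⟨ ℚP.*-cancelˡ-<-nonNeg (fromℕ N) {{ℚ.nonNegative (0≤fromℕ N)}}
                                               (ℚP.≤-<-trans (tail-bound N) (K<Nε N N₀≤N)) ⟩
        ε                                 ∎
        where
        open ℚP.≤-Reasoning
        E : ℕ → ℚ
        E = partialExp G s u
        cancel : ∀ p q → p - (p + q) ≡ - q
        cancel = ℚ-Solver.solve-∀ ℚ-ring

module Adjacency where

  open import Data.Nat using (_<_; _≡ᵇ_)
  import Data.Nat.Properties as ℕP
  import Data.Bool as Bool
  open Bool using (_∧_; _∨_)
  open import Data.Bool.Properties using (T-∧; T-∨)
  open import Data.List using (_∷_)
  open import Data.List.Membership.Propositional using (_∈_)
  open import Data.List.Membership.Propositional.Properties using (∈-filter⁺; ∈-filter⁻; ∈-upTo⁺; ∈-upTo⁻)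
  open import Data.List.Membership.Propositional.Properties.WithK using (unique∧set⇒bag)
  open import Data.List.Relation.Unary.Any using (here; there)
  open import Data.List.Relation.Unary.Unique.Propositional using (Unique)
  open import Data.List.Relation.Unary.Unique.Propositional.Properties using (upTo⁺; filter⁺)
  open import Data.List.Relation.Binary.BagAndSetEquality using (∼bag⇒↭)
  open import Data.List.Relation.Binary.Permutation.Propositional using (_↭_)
  open import Data.Product using (∃-syntax; _×_; _,_)
  open import Data.Sum using (_⊎_; inj₁; inj₂)
  open import Function using (_⇔_; mk⇔; Equivalence)
  open import Relation.Binary.PropositionalEquality

  Joins : ℕ → ℕ → Edge → Set
  Joins v w (x , y) = (x ≡ v × y ≡ w) ⊎ (x ≡ w × y ≡ v)

  private
    Test : ℕ → ℕ → Edge → Set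
    Test v w (x , y) = Bool.T (((x ≡ᵇ v) ∧ (y ≡ᵇ w)) ∨ ((x ≡ᵇ w) ∧ (y ≡ᵇ v)))

    test⇒joins : ∀ {v w} e → Test v w e → Joins v w e
    test⇒joins (x , y) test with Equivalence.to T-∨ test
    ... | inj₁ forward  = let x≡v , y≡w = Equivalence.to T-∧ forward in
                          inj₁ (ℕP.≡ᵇ⇒≡ x _ x≡v , ℕP.≡ᵇ⇒≡ y _ y≡w)
    ... | inj₂ backward = let x≡w , y≡v = Equivalence.to T-∧ backward in
                          inj₂ (ℕP.≡ᵇ⇒≡ x _ x≡w , ℕP.≡ᵇ⇒≡ y _ y≡v)

    joins⇒test : ∀ {v w} e → Joins v w e → Test v w e
    joins⇒test (x , y) (inj₁ (refl , refl)) =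
      Equivalence.from T-∨ (inj₁ (Equivalence.from T-∧ (ℕP.≡⇒≡ᵇ x x refl , ℕP.≡⇒≡ᵇ y y refl)))
    joins⇒test (x , y) (inj₂ (refl , refl)) =
      Equivalence.from T-∨ (inj₂ (Equivalence.from T-∧ (ℕP.≡⇒≡ᵇ x x refl , ℕP.≡⇒≡ᵇ y y refl)))

  adj-sound : ∀ G {v w} → Bool.T (adj G v w) → ∃[ e ] e ∈ edges G × Joins v w e
  adj-sound G = sound (edges G)
    where
    sound : ∀ {v w} L → Bool.T (adj (record { size = size G ; edges = L }) v w) → ∃[ e ] e ∈ L × Joins v w e
    sound (e ∷ L) adj-true with Equivalence.to T-∨ adj-true
    ... | inj₁ test = e , here refl , test⇒joins e test
    ... | inj₂ rest = let e′ , e′∈L , joins = sound L rest in e′ , there e′∈L , joins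

  adj-complete : ∀ G {v w e} → e ∈ edges G → Joins v w e → Bool.T (adj G v w)
  adj-complete G = complete (edges G)
    where
    complete : ∀ {v w e} L → e ∈ L → Joins v w e → Bool.T (adj (record { size = size G ; edges = L }) v w)
    complete (e ∷ L) (here refl) joins = Equivalence.from T-∨ (inj₁ (joins⇒test e joins))
    complete (e ∷ L) (there e∈L) joins = Equivalence.from T-∨ (inj₂ (complete L e∈L joins))

  ∈-neighbours⁻ : ∀ {G v w} → w ∈ neighbours G v → w < size G × Bool.T (adj G v w)
  ∈-neighbours⁻ w∈ = let w∈V , adj-true = ∈-filter⁻ _ w∈ in ∈-upTo⁻ w∈V , adj-true

  ∈-neighbours⁺ : ∀ {G v w} → w < size G → Bool.T (adj G v w) → w ∈ neighbours G v
  ∈-neighbours⁺ w<size adj-true = ∈-filter⁺ _ (∈-upTo⁺ w<size) adj-true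

  neighbours-↭ : ∀ {G v L} → Unique L → (∀ {w} → w ∈ L ⇔ (w < size G × Bool.T (adj G v w))) →
                 neighbours G v ↭ L
  neighbours-↭ {G} {v} unique L⇔adj = ∼bag⇒↭ (unique∧set⇒bag (filter⁺ _ (upTo⁺ (size G))) unique (mk⇔
    (λ w∈ → Equivalence.from L⇔adj (∈-neighbours⁻ {G} {v} w∈))
    (λ w∈ → let w<size , adj-true = Equivalence.to L⇔adj w∈ in ∈-neighbours⁺ {G} {v} w<size adj-true)))

module Blocks where

  open import Data.Nat using (_+_; _≤_; _<_)
  import Data.Nat.Properties as ℕP
  open import Data.List using ([]; _∷_; map)
  open import Data.Nat.ListAction using (sum)
  open import Data.List.Membership.Propositional using (_∈_)
  open import Data.List.Membership.Propositional.Properties using (∈-map⁻)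
  open import Data.List.Relation.Unary.Any using (here; there)
  open import Data.List.Relation.Unary.All as All using (All; []; _∷_)
  open import Data.List.Relation.Unary.Unique.Propositional using (Unique; []; _∷_)
  open import Data.Product using (∃-syntax; _×_; _,_; proj₁; proj₂)
  open import Data.Empty using (⊥-elim)
  open import Relation.Nullary using (yes; no)
  open import Relation.Binary.PropositionalEquality
  open NatArithmetic

  blocks : ℕ → List ℕ → List (ℕ × ℕ)
  blocks o []       = []
  blocks o (c ∷ cs) = (o , c) ∷ blocks (o + c) cs

  blocks-sizes : ∀ o cs → map proj₂ (blocks o cs) ≡ cs
  blocks-sizes o []       = refl
  blocks-sizes o (c ∷ cs) = cong (c ∷_) (blocks-sizes (o + c) cs)

  blocks-All : ∀ {P : ℕ → Set} {o cs o′ c′} → All P cs → (o′ , c′) ∈ blocks o cs → P c′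
  blocks-All (pc ∷ _)   (here refl)  = pc
  blocks-All (_  ∷ pcs) (there b∈bs) = blocks-All pcs b∈bs

  blocks-start : ∀ {o cs o′ c′} → (o′ , c′) ∈ blocks o cs → o ≤ o′
  blocks-start {o} {c ∷ cs} (here refl)  = ℕP.≤-refl
  blocks-start {o} {c ∷ cs} (there b∈bs) = ℕP.≤-trans (ℕP.m≤m+n o c) (blocks-start b∈bs)

  blocks-end : ∀ {o cs o′ c′} → (o′ , c′) ∈ blocks o cs → o′ + c′ ≤ o + sum cs
  blocks-end {o} {c ∷ cs} (here refl)  = ℕP.+-monoʳ-≤ o (ℕP.m≤m+n c (sum cs))
  blocks-end {o} {c ∷ cs} (there b∈bs) = ℕP.≤-trans (blocks-end b∈bs) (ℕP.≤-reflexive (ℕP.+-assoc o c (sum cs)))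

  blocks-starts-unique : ∀ {o cs} → All (1 ≤_) cs → Unique (map proj₁ (blocks o cs))
  blocks-starts-unique {o} {[]}     []            = []
  blocks-starts-unique {o} {c ∷ cs} (1≤c ∷ cs≥1) = All.tabulate later-start ∷ blocks-starts-unique cs≥1
    where
    later-start : ∀ {x} → x ∈ map proj₁ (blocks (o + c) cs) → o ≢ x
    later-start x∈ with ∈-map⁻ proj₁ x∈
    ... | _ , b∈ , refl = ℕP.<⇒≢ (ℕP.<-≤-trans (ℕP.m<m+n o 1≤c) (blocks-start b∈))

  blocks-disjoint : ∀ {o cs o₁ c₁ p₁ o₂ c₂ p₂} → (o₁ , c₁) ∈ blocks o cs → (o₂ , c₂) ∈ blocks o cs →
                    p₁ < c₁ → p₂ < c₂ → o₁ + p₁ ≡ o₂ + p₂ → o₁ ≡ o₂ × c₁ ≡ c₂ × p₁ ≡ p₂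
  blocks-disjoint {o} {c ∷ cs} (here refl) (here refl) _ _ eq = refl , refl , ℕP.+-cancelˡ-≡ o _ _ eq
  blocks-disjoint {o} {c ∷ cs} (here refl) (there b₂) p₁<c _ eq =
    ⊥-elim (ℕP.<⇒≱ (ℕP.+-monoʳ-< o p₁<c) (ℕP.≤-trans (blocks-start b₂) (m+n≡o⇒m≤o (sym eq))))
  blocks-disjoint {o} {c ∷ cs} (there b₁) (here refl) _ p₂<c eq =
    ⊥-elim (ℕP.<⇒≱ (ℕP.+-monoʳ-< o p₂<c) (ℕP.≤-trans (blocks-start b₁) (m+n≡o⇒m≤o eq)))
  blocks-disjoint {o} {c ∷ cs} (there b₁) (there b₂) p₁<c₁ p₂<c₂ eq = blocks-disjoint b₁ b₂ p₁<c₁ p₂<c₂ eq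

  blocks-cover : ∀ {o} cs p → o + p < o + sum cs →
                 ∃[ o′ ] ∃[ c′ ] ∃[ p′ ] (o′ , c′) ∈ blocks o cs × p′ < c′ × o + p ≡ o′ + p′
  blocks-cover {o} []       p o+p<o+0 =
    ⊥-elim (ℕP.<⇒≱ o+p<o+0 (ℕP.≤-trans (ℕP.≤-reflexive (ℕP.+-identityʳ o)) (ℕP.m≤m+n o p)))
  blocks-cover {o} (c ∷ cs) p o+p<end with p ℕP.<? c
  ... | yes p<c = o , c , p , here refl , p<c , refl
  ... | no p≮c  with ℕP.m≤n⇒∃[o]m+o≡n (ℕP.≮⇒≥ p≮c)
  ...   | q , refl =
    let o′ , c′ , p′ , b∈bs , p′<c′ , eq =
          blocks-cover cs q (subst₂ _<_ (sym (ℕP.+-assoc o c q)) (sym (ℕP.+-assoc o c (sum cs))) o+p<end)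
    in o′ , c′ , p′ , there b∈bs , p′<c′ , trans (sym (ℕP.+-assoc o c q)) eq

module TreeEdges (n k : ℕ) (cs : List ℕ) where

  open import Data.Nat using (suc; s≤s; _+_; _∸_; _<_)
  import Data.Nat.Properties as ℕP
  open import Data.List using (_∷_)
  open import Data.List.Membership.Propositional using (_∈_)
  open import Data.List.Membership.Propositional.Properties
    using (∈-map⁺; ∈-map⁻; ∈-upTo⁺; ∈-upTo⁻; ∈-++⁺ˡ; ∈-++⁺ʳ; ∈-++⁻)
  open import Data.List.Relation.Unary.Any using (here; there)
  open import Data.Product using (∃-syntax; _×_; _,_)
  open import Data.Sum using (inj₁; inj₂)
  open import Function using (_⇔_; mk⇔)
  import Data.Bool as Bool
  open import Relation.Binary.PropositionalEquality
  open Blocks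
  open Adjacency

  data PendantEdge (a : ℕ) (bs : List (ℕ × ℕ)) : Edge → Set where
    attach : ∀ {o c}   → (o , c) ∈ bs → PendantEdge a bs (a , o)
    along  : ∀ {o c p} → (o , c) ∈ bs → suc p < c → PendantEdge a bs (o + p , o + suc p)

  ∈-pathEdges⁻ : ∀ {o c e} → e ∈ pathEdges o c → ∃[ p ] suc p < c × e ≡ (o + p , o + suc p)
  ∈-pathEdges⁻ {o} {suc c} e∈ with ∈-map⁻ _ e∈
  ... | p , p∈ , refl = p , s≤s (∈-upTo⁻ p∈) , refl

  ∈-pathEdges⁺ : ∀ {o c p} → suc p < c → (o + p , o + suc p) ∈ pathEdges o c
  ∈-pathEdges⁺ {o} {suc c} p+1<c = ∈-map⁺ _ (∈-upTo⁺ (ℕP.≤-pred p+1<c))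

  ∈-pendantEdges⁻ : ∀ {a o} cs {e} → e ∈ pendantEdges a o cs → PendantEdge a (blocks o cs) e
  ∈-pendantEdges⁻ {a} {o} (c ∷ cs) e∈ with ∈-++⁻ ((a , o) ∷ pathEdges o c) e∈
  ... | inj₁ (here refl)    = attach (here refl)
  ... | inj₁ (there e∈path) with ∈-pathEdges⁻ {o} {c} e∈path
  ...   | p , p+1<c , refl  = along (here refl) p+1<c
  ∈-pendantEdges⁻ (c ∷ cs) e∈ | inj₂ e∈rest with ∈-pendantEdges⁻ cs e∈rest
  ...   | attach b∈         = attach (there b∈)
  ...   | along b∈ p+1<c    = along (there b∈) p+1<c

  ∈-pendantEdges⁺ : ∀ {a o} cs {e} → PendantEdge a (blocks o cs) e → e ∈ pendantEdges a o cs
  ∈-pendantEdges⁺ {a} {o} (c ∷ cs) (attach (here refl))      = ∈-++⁺ˡ {ys = pendantEdges a (o + c) cs} (here refl)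
  ∈-pendantEdges⁺ {a} {o} (c ∷ cs) (along (here refl) p+1<c) =
    ∈-++⁺ˡ {ys = pendantEdges a (o + c) cs} (there (∈-pathEdges⁺ p+1<c))
  ∈-pendantEdges⁺ (c ∷ cs) (attach (there b∈))      = ∈-++⁺ʳ _ (∈-pendantEdges⁺ cs (attach b∈))
  ∈-pendantEdges⁺ (c ∷ cs) (along (there b∈) p+1<c) = ∈-++⁺ʳ _ (∈-pendantEdges⁺ cs (along b∈ p+1<c))

  -- blocks 0 (n ∷ cs) = (0 , n) ∷ blocks n cs: the spine is the first of the paths.
  data Adjacent : ℕ → ℕ → Set where
    next : ∀ {o c p} → (o , c) ∈ blocks 0 (n ∷ cs) → suc p < c → Adjacent (o + p) (o + suc p)
    prev : ∀ {o c p} → (o , c) ∈ blocks 0 (n ∷ cs) → suc p < c → Adjacent (o + suc p) (o + p)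
    down : ∀ {o c} → (o , c) ∈ blocks n cs → Adjacent (k ∸ 1) o
    up   : ∀ {o c} → (o , c) ∈ blocks n cs → Adjacent o (k ∸ 1)

  Adjacent-sym : ∀ {v w} → Adjacent v w → Adjacent w v
  Adjacent-sym (next b∈ p+1<c) = prev b∈ p+1<c
  Adjacent-sym (prev b∈ p+1<c) = next b∈ p+1<c
  Adjacent-sym (down b∈)       = up b∈
  Adjacent-sym (up b∈)         = down b∈

  edge⇒Adjacent : ∀ {x y} → (x , y) ∈ TEdges n k cs → Adjacent x y
  edge⇒Adjacent e∈ with ∈-++⁻ (spineEdges n) e∈
  ... | inj₁ e∈spine with ∈-pathEdges⁻ {0} {n} e∈spine
  ...   | p , p+1<n , refl = next (here refl) p+1<n
  edge⇒Adjacent e∈ | inj₂ e∈pendant with ∈-pendantEdges⁻ cs e∈pendant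
  ...   | attach b∈        = down b∈
  ...   | along b∈ p+1<c   = next (there b∈) p+1<c

  along⇒edge : ∀ {o c p} → (o , c) ∈ blocks 0 (n ∷ cs) → suc p < c → (o + p , o + suc p) ∈ TEdges n k cs
  along⇒edge (here refl) p+1<n = ∈-++⁺ˡ (∈-pathEdges⁺ {0} p+1<n)
  along⇒edge (there b∈)  p+1<c = ∈-++⁺ʳ (spineEdges n) (∈-pendantEdges⁺ cs (along b∈ p+1<c))

  attach⇒edge : ∀ {o c} → (o , c) ∈ blocks n cs → (k ∸ 1 , o) ∈ TEdges n k cs
  attach⇒edge b∈ = ∈-++⁺ʳ (spineEdges n) (∈-pendantEdges⁺ cs (attach b∈))

  adjacent⇔ : ∀ {v w} → Bool.T (adj (T n k cs) v w) ⇔ Adjacent v w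
  adjacent⇔ {v} {w} = mk⇔ to from
    where
    to : Bool.T (adj (T n k cs) v w) → Adjacent v w
    to adj-true with adj-sound (T n k cs) adj-true
    ... | _ , e∈ , inj₁ (refl , refl) = edge⇒Adjacent e∈
    ... | _ , e∈ , inj₂ (refl , refl) = Adjacent-sym (edge⇒Adjacent e∈)
    from : Adjacent v w → Bool.T (adj (T n k cs) v w)
    from (next b∈ p+1<c) = adj-complete (T n k cs) (along⇒edge b∈ p+1<c) (inj₁ (refl , refl))
    from (prev b∈ p+1<c) = adj-complete (T n k cs) (along⇒edge b∈ p+1<c) (inj₂ (refl , refl))
    from (down b∈)       = adj-complete (T n k cs) (attach⇒edge b∈) (inj₁ (refl , refl))
    from (up b∈)         = adj-complete (T n k cs) (attach⇒edge b∈) (inj₂ (refl , refl))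

module ClosedForm where

  open import Data.Nat as ℕ using (suc; _∸_)
  open import Data.Integer using (ℤ; +_; _+_; _-_; _*_)
  import Data.Integer.Properties as ℤP
  open import Data.Integer.Tactic.RingSolver using (solve-∀)
  open import Relation.Binary.PropositionalEquality

  nearFormula : ℕ → ℕ → ℕ → ℕ → ℤ
  nearFormula n k i d = (+ n * + n) - (+ k * + k) + (+ 2 * (+ d - + 1)) * (+ n - + k)
                        + (+ (k ∸ 1) * + (k ∸ 1)) - (+ (i ∸ 1) * + (i ∸ 1))

  farFormula : ℕ → ℕ → ℕ → ℤ
  farFormula n i d = (+ n * + n) - (+ i * + i) + (+ 2 * (+ d - + 1)) * (+ n - + i)

  private
    pos-quadratic : ∀ r x z → + (r ℕ.* (r ℕ.+ 2 ℕ.* x ℕ.+ 2 ℕ.* z)) ≡ + r * (+ r + + 2 * + x + + 2 * + z)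
    pos-quadratic r x z =
      trans (ℤP.pos-* r _) (cong₂ (λ p q → + r * (+ r + p + q)) (ℤP.pos-* 2 x) (ℤP.pos-* 2 z))

  far-closed : ∀ s r d {n i} → suc s ≡ i → s ℕ.+ suc r ≡ n →
               + (r ℕ.* (r ℕ.+ 2 ℕ.* s ℕ.+ 2 ℕ.* d)) ≡ farFormula n i d
  far-closed s r d refl refl = trans (pos-quadratic r s d) (identity (+ s) (+ r) (+ d))
    where
    identity : ∀ S R D → R * (R + + 2 * S + + 2 * D)
             ≡ ((S + (+ 1 + R)) * (S + (+ 1 + R))) - ((+ 1 + S) * (+ 1 + S))
               + (+ 2 * (D - + 1)) * ((S + (+ 1 + R)) - (+ 1 + S))
    identity = solve-∀

  near-closed : ∀ s b r d {n k i a} → suc s ≡ i → s ℕ.+ b ≡ a → suc a ≡ k → a ℕ.+ suc r ≡ n →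
                + (r ℕ.* (r ℕ.+ 2 ℕ.* a ℕ.+ 2 ℕ.* d) ℕ.+ b ℕ.* (b ℕ.+ 2 ℕ.* s)) ≡ nearFormula n k i d
  near-closed s b r d refl refl refl refl =
    trans (cong₂ _+_ (pos-quadratic r (s ℕ.+ b) d)
                     (trans (ℤP.pos-* b _) (cong (λ p → + b * (+ b + p)) (ℤP.pos-* 2 s))))
          (identity (+ s) (+ b) (+ r) (+ d))
    where
    identity : ∀ S B R D → R * (R + + 2 * (S + B) + + 2 * D) + B * (B + + 2 * S)
             ≡ (((S + B) + (+ 1 + R)) * ((S + B) + (+ 1 + R))) - ((+ 1 + (S + B)) * (+ 1 + (S + B)))
               + (+ 2 * (D - + 1)) * (((S + B) + (+ 1 + R)) - (+ 1 + (S + B)))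
               + ((S + B) * (S + B)) - (S * S)
    identity = solve-∀

-- Opened only here, so as not to clash with the orders of ℚ opened in the modules above.
open import Data.Nat using (suc; _≤_; _<_)
open import Data.List.Relation.Unary.All using (All)

-- k = a₀ + 2, so that v_k has the label a = a₀ + 1 and its left neighbour the label a₀.
module TreeStructure (n a₀ : ℕ) (cs : List ℕ) (a+1<n : suc (suc a₀) < n) (cs≥1 : All (1 ≤_) cs) where

  open import Data.Nat using (z≤n; s≤s; _+_)
  import Data.Nat.Properties as ℕP
  open import Data.List using ([]; _∷_; map)
  open import Data.Nat.ListAction using (sum)
  open import Data.List.Membership.Propositional using (_∈_)
  open import Data.List.Membership.Propositional.Properties using (∈-map⁺; ∈-map⁻)
  open import Data.List.Relation.Unary.Any using (here; there)
  open import Data.List.Relation.Unary.All as All using ([]; _∷_)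
  open import Data.List.Relation.Unary.Unique.Propositional using (Unique; []; _∷_)
  open import Data.List.Relation.Binary.Permutation.Propositional using (_↭_)
  open import Data.Product using (∃-syntax; _×_; _,_; proj₁)
  open import Data.Sum using (_⊎_; inj₁; inj₂)
  open import Data.Empty using (⊥-elim)
  open import Function using (mk⇔; Equivalence)
  open import Relation.Binary.PropositionalEquality
  open NatArithmetic
  open Blocks
  open Adjacency
  open TreeEdges n (suc (suc a₀)) cs

  a : ℕ
  a = suc a₀

  d : ℕ
  d = sum cs

  G : Graph
  G = T n (suc (suc a₀)) cs

  pendants : List (ℕ × ℕ)
  pendants = blocks n cs

  starts : List ℕ
  starts = map proj₁ pendants

  a<n : a < n
  a<n = ℕP.<-trans (ℕP.n<1+n a) a+1<n

  1<n : 1 < n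
  1<n = ℕP.≤-<-trans (s≤s z≤n) a+1<n

  n≤start : ∀ {o} → o ∈ starts → n ≤ o
  n≤start o∈ with ∈-map⁻ proj₁ o∈
  ... | _ , b∈ , refl = blocks-start b∈

  spine≢start : ∀ {y x} → y < n → x ∈ starts → y ≢ x
  spine≢start y<n x∈ = ℕP.<⇒≢ (ℕP.<-≤-trans y<n (n≤start x∈))

  start<size : ∀ {o} → o ∈ starts → o < size G
  start<size o∈ with ∈-map⁻ proj₁ o∈
  ... | (o , _) , b∈ , refl = ℕP.<-≤-trans (ℕP.m<m+n o (blocks-All cs≥1 b∈)) (blocks-end b∈)

  adjacent-bounded : ∀ {v w} → Adjacent v w → w < size G
  adjacent-bounded (next {o} b∈ p+1<c) = ℕP.<-≤-trans (ℕP.+-monoʳ-< o p+1<c) (blocks-end b∈)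
  adjacent-bounded (prev {o} b∈ p+1<c) =
    ℕP.<-≤-trans (ℕP.+-monoʳ-< o (ℕP.<-trans (ℕP.n<1+n _) p+1<c)) (blocks-end b∈)
  adjacent-bounded (down b∈)           = start<size (∈-map⁺ proj₁ b∈)
  adjacent-bounded (up _)              = ℕP.<-≤-trans a<n (ℕP.m≤m+n n d)

  neighbours-of : ∀ {v L} → Unique L → (∀ {w} → w ∈ L → Adjacent v w) → (∀ {w} → Adjacent v w → w ∈ L) →
                  neighbours G v ↭ L
  neighbours-of {v} unique listed complete = neighbours-↭ {G} {v} unique (mk⇔
    (λ w∈L → adjacent-bounded (listed w∈L) , Equivalence.from adjacent⇔ (listed w∈L))
    (λ (_ , adj-true) → complete (Equivalence.to adjacent⇔ adj-true)))

  adjacent-along : ∀ {o c p v w} → (o , c) ∈ blocks 0 (n ∷ cs) → p < c → v ≡ o + p → Adjacent v w →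
    (∃[ p′ ] p ≡ suc p′ × w ≡ o + p′) ⊎ (suc p < c × w ≡ o + suc p) ⊎ (v ≡ a × w ∈ starts) ⊎ (w ≡ a × v ∈ starts)
  adjacent-along b∈ p<c v≡ (next b′∈ p′+1<c′)
    with blocks-disjoint b′∈ b∈ (ℕP.<-trans (ℕP.n<1+n _) p′+1<c′) p<c v≡
  ... | refl , refl , refl = inj₂ (inj₁ (p′+1<c′ , refl))
  adjacent-along b∈ p<c v≡ (prev b′∈ p′+1<c′) with blocks-disjoint b′∈ b∈ p′+1<c′ p<c v≡
  ... | refl , refl , refl = inj₁ (_ , refl , refl)
  adjacent-along b∈ p<c v≡ (down b′∈) = inj₂ (inj₂ (inj₁ (refl , ∈-map⁺ proj₁ b′∈)))
  adjacent-along b∈ p<c v≡ (up b′∈)   = inj₂ (inj₂ (inj₂ (refl , ∈-map⁺ proj₁ b′∈)))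

  adjacent-spine : ∀ {p w} → p < n → Adjacent p w →
    (∃[ p′ ] p ≡ suc p′ × w ≡ p′) ⊎ (suc p < n × w ≡ suc p) ⊎ (p ≡ a × w ∈ starts)
  adjacent-spine p<n adjacent with adjacent-along (here refl) p<n refl adjacent
  ... | inj₁ before                    = inj₁ before
  ... | inj₂ (inj₁ after)              = inj₂ (inj₁ after)
  ... | inj₂ (inj₂ (inj₁ attached))    = inj₂ (inj₂ attached)
  ... | inj₂ (inj₂ (inj₂ (_ , p∈)))    = ⊥-elim (spine≢start p<n p∈ refl)

  adjacent-pendant : ∀ {o c p v w} → (o , c) ∈ pendants → p < c → v ≡ o + p → Adjacent v w →
    (∃[ p′ ] p ≡ suc p′ × w ≡ o + p′) ⊎ (suc p < c × w ≡ o + suc p) ⊎ (p ≡ 0 × w ≡ a)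
  adjacent-pendant {o} {c} {p} b∈ p<c v≡ adjacent with adjacent-along (there b∈) p<c v≡ adjacent
  ... | inj₁ before                    = inj₁ before
  ... | inj₂ (inj₁ after)              = inj₂ (inj₁ after)
  ... | inj₂ (inj₂ (inj₁ (v≡a , _)))   =
    ⊥-elim (ℕP.<⇒≱ a<n (ℕP.≤-trans (blocks-start b∈) (m+n≡o⇒m≤o (trans (sym v≡) v≡a))))
  ... | inj₂ (inj₂ (inj₂ (w≡a , v∈))) with ∈-map⁻ proj₁ v∈
  ...   | _ , b′∈ , refl with blocks-disjoint b′∈ b∈ (blocks-All cs≥1 b′∈) p<c (trans (ℕP.+-identityʳ _) v≡)
  ...     | _ , _ , 0≡p = inj₂ (inj₂ (sym 0≡p , w≡a))

  neighbours-spine-end : neighbours G 0 ↭ 1 ∷ []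
  neighbours-spine-end = neighbours-of ([] ∷ []) listed complete
    where
    listed : ∀ {w} → w ∈ 1 ∷ [] → Adjacent 0 w
    listed (here refl) = next {p = 0} (here refl) 1<n
    complete : ∀ {w} → Adjacent 0 w → w ∈ 1 ∷ []
    complete adjacent with adjacent-spine (ℕP.<-trans (s≤s z≤n) 1<n) adjacent
    ... | inj₂ (inj₁ (_ , refl)) = here refl

  neighbours-spine-inner : ∀ {y} → suc (suc y) < n → suc y ≢ a → neighbours G (suc y) ↭ y ∷ suc (suc y) ∷ []
  neighbours-spine-inner {y} y+2<n y+1≢a = neighbours-of ((y≢y+2 ∷ []) ∷ [] ∷ []) listed complete
    where
    y≢y+2 : y ≢ suc (suc y)
    y≢y+2 = ℕP.<⇒≢ (s≤s (ℕP.n≤1+n y))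
    y+1<n : suc y < n
    y+1<n = ℕP.<-trans (ℕP.n<1+n _) y+2<n
    listed : ∀ {w} → w ∈ y ∷ suc (suc y) ∷ [] → Adjacent (suc y) w
    listed (here refl)         = prev {p = y} (here refl) y+1<n
    listed (there (here refl)) = next {p = suc y} (here refl) y+2<n
    complete : ∀ {w} → Adjacent (suc y) w → w ∈ y ∷ suc (suc y) ∷ []
    complete adjacent with adjacent-spine y+1<n adjacent
    ... | inj₁ (_ , refl , refl)   = here refl
    ... | inj₂ (inj₁ (_ , refl))   = there (here refl)
    ... | inj₂ (inj₂ (y+1≡a , _))  = ⊥-elim (y+1≢a y+1≡a)

  neighbours-attachment : neighbours G a ↭ a₀ ∷ suc a ∷ starts
  neighbours-attachment = neighbours-of unique listed complete
    where
    a₀<n : a₀ < n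
    a₀<n = ℕP.<-trans (ℕP.n<1+n a₀) a<n
    unique : Unique (a₀ ∷ suc a ∷ starts)
    unique = (ℕP.<⇒≢ (s≤s (ℕP.n≤1+n a₀)) ∷ All.tabulate (spine≢start a₀<n))
           ∷ All.tabulate (spine≢start a+1<n)
           ∷ blocks-starts-unique cs≥1
    listed : ∀ {w} → w ∈ a₀ ∷ suc a ∷ starts → Adjacent a w
    listed (here refl)               = prev {p = a₀} (here refl) a<n
    listed (there (here refl))       = next {p = a} (here refl) a+1<n
    listed (there (there w∈starts)) with ∈-map⁻ proj₁ w∈starts
    ... | _ , b∈ , refl = down b∈
    complete : ∀ {w} → Adjacent a w → w ∈ a₀ ∷ suc a ∷ starts
    complete adjacent with adjacent-spine a<n adjacent
    ... | inj₁ (_ , refl , refl)       = here refl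
    ... | inj₂ (inj₁ (_ , refl))       = there (here refl)
    ... | inj₂ (inj₂ (_ , w∈starts))   = there (there w∈starts)

  neighbours-pendant-leaf : ∀ {o} → (o , 1) ∈ pendants → neighbours G o ↭ a ∷ []
  neighbours-pendant-leaf {o} b∈ = neighbours-of ([] ∷ []) listed complete
    where
    listed : ∀ {w} → w ∈ a ∷ [] → Adjacent o w
    listed (here refl) = up b∈
    complete : ∀ {w} → Adjacent o w → w ∈ a ∷ []
    complete adjacent with adjacent-pendant b∈ (s≤s z≤n) (sym (ℕP.+-identityʳ o)) adjacent
    ... | inj₂ (inj₁ (s≤s () , _))
    ... | inj₂ (inj₂ (_ , refl)) = here refl

  neighbours-pendant-root : ∀ {o q} → (o , suc (suc q)) ∈ pendants → neighbours G o ↭ a ∷ o + 1 ∷ []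
  neighbours-pendant-root {o} b∈ = neighbours-of ((a≢o+1 ∷ []) ∷ [] ∷ []) listed complete
    where
    a≢o+1 : a ≢ o + 1
    a≢o+1 = ℕP.<⇒≢ (ℕP.<-≤-trans a<n (ℕP.≤-trans (blocks-start b∈) (ℕP.m≤m+n o 1)))
    listed : ∀ {w} → w ∈ a ∷ o + 1 ∷ [] → Adjacent o w
    listed (here refl)         = up b∈
    listed (there (here refl)) =
      subst (λ x → Adjacent x (o + 1)) (ℕP.+-identityʳ o) (next {p = 0} (there b∈) (s≤s (s≤s z≤n)))
    complete : ∀ {w} → Adjacent o w → w ∈ a ∷ o + 1 ∷ []
    complete adjacent with adjacent-pendant b∈ (s≤s z≤n) (sym (ℕP.+-identityʳ o)) adjacent
    ... | inj₂ (inj₁ (_ , refl))  = there (here refl)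
    ... | inj₂ (inj₂ (_ , refl))  = here refl

  neighbours-pendant-end : ∀ {o p} → (o , suc (suc p)) ∈ pendants → neighbours G (o + suc p) ↭ o + p ∷ []
  neighbours-pendant-end {o} {p} b∈ = neighbours-of ([] ∷ []) listed complete
    where
    listed : ∀ {w} → w ∈ o + p ∷ [] → Adjacent (o + suc p) w
    listed (here refl) = prev {p = p} (there b∈) ℕP.≤-refl
    complete : ∀ {w} → Adjacent (o + suc p) w → w ∈ o + p ∷ []
    complete adjacent with adjacent-pendant b∈ ℕP.≤-refl refl adjacent
    ... | inj₁ (_ , refl , refl)       = here refl
    ... | inj₂ (inj₁ (p+2<p+2 , _))    = ⊥-elim (ℕP.<-irrefl refl p+2<p+2)

  neighbours-pendant-inner : ∀ {o c p} → (o , c) ∈ pendants → suc (suc p) < c →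
                             neighbours G (o + suc p) ↭ o + p ∷ o + suc (suc p) ∷ []
  neighbours-pendant-inner {o} {c} {p} b∈ p+2<c = neighbours-of ((distinct ∷ []) ∷ [] ∷ []) listed complete
    where
    distinct : o + p ≢ o + suc (suc p)
    distinct = ℕP.<⇒≢ (ℕP.+-monoʳ-< o (s≤s (ℕP.n≤1+n p)))
    p+1<c : suc p < c
    p+1<c = ℕP.<-trans (ℕP.n<1+n _) p+2<c
    listed : ∀ {w} → w ∈ o + p ∷ o + suc (suc p) ∷ [] → Adjacent (o + suc p) w
    listed (here refl)         = prev {p = p} (there b∈) p+1<c
    listed (there (here refl)) = next {p = suc p} (there b∈) p+2<c
    complete : ∀ {w} → Adjacent (o + suc p) w → w ∈ o + p ∷ o + suc (suc p) ∷ []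
    complete adjacent with adjacent-pendant b∈ p+1<c refl adjacent
    ... | inj₁ (_ , refl , refl)  = here refl
    ... | inj₂ (inj₁ (_ , refl))  = there (here refl)

module TreePotential (n a₀ : ℕ) (cs : List ℕ) (a+1<n : suc (suc a₀) < n) (cs≥1 : All (1 ≤_) cs) where

  open import Data.Nat using (zero; z≤n; s≤s; _+_; _*_; _∸_; _<ᵇ_; NonZero)
  import Data.Nat.Properties as ℕP
  open import Data.List using ([]; _∷_; map; length)
  open import Data.Nat.ListAction using (sum)
  open import Data.List.Membership.Propositional using (_∈_)
  open import Data.List.Relation.Unary.Any using (here; there)
  open import Data.List.Relation.Binary.Permutation.Propositional using (_↭_)
  open import Data.List.Relation.Binary.Permutation.Propositional.Properties using (↭-length; map⁺)
  open import Data.Nat.ListAction.Properties using (sum-↭)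
  open import Data.Product using (_,_; proj₁; proj₂)
  open import Data.Bool using (if_then_else_)
  open import Relation.Binary.Definitions using (tri<; tri≈; tri>)
  open import Relation.Binary.PropositionalEquality
  open import Data.Nat.Tactic.RingSolver using (solve-∀)
  import Data.Integer as ℤ
  open NatEmbedding
  open NatTests
  open NatArithmetic
  open ClosedForm
  open Blocks
  open TreeStructure n a₀ cs a+1<n cs≥1

  rightPotential : ℕ → ℕ
  rightPotential x = (n ∸ 1 ∸ x) * ((n ∸ 1 ∸ x) + 2 * x + 2 * d)

  fₐ : ℕ
  fₐ = rightPotential a

  blockPotential : ℕ → ℕ → ℕ → ℕ
  blockPotential o c x = fₐ + suc (x ∸ o) * (suc (x ∸ o) + 2 * (o + c ∸ suc x))

  pendantPotential : ℕ → List ℕ → ℕ → ℕ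
  pendantPotential o []        x = 0
  pendantPotential o (c ∷ cs′) x = if x <ᵇ o + c then blockPotential o c x else pendantPotential (o + c) cs′ x

  potential : ℕ → ℕ
  potential x = if x <ᵇ a then fₐ + (a ∸ x) * ((a ∸ x) + 2 * x)
                else if x <ᵇ n then rightPotential x
                else pendantPotential n cs x

  rightPotential-value : ∀ x r → x + suc r ≡ n → rightPotential x ≡ r * (r + 2 * x + 2 * d)
  rightPotential-value x r x+r+1≡n = cong (λ m → m * (m + 2 * x + 2 * d)) (m+[1+n]≡o⇒o∸1∸m≡n x+r+1≡n)

  potential-right : ∀ x r → a ≤ x → x + suc r ≡ n → potential x ≡ r * (r + 2 * x + 2 * d)
  potential-right x r a≤x x+r+1≡n rewrite <ᵇ-false a≤x | <ᵇ-true (m+[1+n]≡o⇒m<o x+r+1≡n) =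
    rightPotential-value x r x+r+1≡n

  potential-a : potential a ≡ fₐ
  potential-a rewrite <ᵇ-false (ℕP.≤-refl {a}) | <ᵇ-true a<n = refl

  potential-left : ∀ x b → x + b ≡ a → potential x ≡ fₐ + b * (b + 2 * x)
  potential-left x zero    x+0≡a =
    trans (cong potential (trans (sym (ℕP.+-identityʳ x)) x+0≡a)) (trans potential-a (sym (ℕP.+-identityʳ fₐ)))
  potential-left x (suc b) x+b≡a rewrite <ᵇ-true (m+[1+n]≡o⇒m<o x+b≡a) =
    cong (λ m → fₐ + m * (m + 2 * x)) (m+n≡o⇒o∸m≡n x+b≡a)

  pendantPotential-block : ∀ {o₀ bs o c x} → (o , c) ∈ blocks o₀ bs → o ≤ x → x < o + c →
                           pendantPotential o₀ bs x ≡ blockPotential o c x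
  pendantPotential-block {bs = c ∷ bs} (here refl) o≤x x<o+c rewrite <ᵇ-true x<o+c = refl
  pendantPotential-block {o₀} {c₀ ∷ bs} {x = x} (there b∈) o≤x x<o+c
    rewrite <ᵇ-false {x} {o₀ + c₀} (ℕP.≤-trans (blocks-start b∈) o≤x) = pendantPotential-block b∈ o≤x x<o+c

  potential-pendant : ∀ {o c} p q → (o , c) ∈ pendants → p + suc q ≡ c →
                      potential (o + p) ≡ fₐ + suc p * (suc p + 2 * q)
  potential-pendant {o} {c} p q b∈ p+q+1≡c = begin
    potential (o + p)                ≡⟨ beyond-spine ⟩
    pendantPotential n cs (o + p)    ≡⟨ pendantPotential-block b∈ (ℕP.m≤m+n o p) o+p<o+c ⟩
    blockPotential o c (o + p)       ≡⟨ cong₂ (λ s t → fₐ + suc s * (suc s + 2 * t)) (ℕP.m+n∸m≡n o p) q≡ ⟩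
    fₐ + suc p * (suc p + 2 * q)     ∎
    where
    open ≡-Reasoning
    n≤o+p : n ≤ o + p
    n≤o+p = ℕP.≤-trans (blocks-start b∈) (ℕP.m≤m+n o p)
    o+p<o+c : o + p < o + c
    o+p<o+c = ℕP.+-monoʳ-< o (m+[1+n]≡o⇒m<o p+q+1≡c)
    beyond-spine : potential (o + p) ≡ pendantPotential n cs (o + p)
    beyond-spine rewrite <ᵇ-false {o + p} {a} (ℕP.≤-trans (ℕP.<⇒≤ a<n) n≤o+p) | <ᵇ-false n≤o+p = refl
    q≡ : o + c ∸ suc (o + p) ≡ q
    q≡ = m+n≡o⇒o∸m≡n (trans (sym (ℕP.+-suc (o + p) q)) (trans (ℕP.+-assoc o p (suc q)) (cong (o +_) p+q+1≡c)))

  potential-start : ∀ {o c} q → (o , c) ∈ pendants → suc q ≡ c → potential o ≡ fₐ + 1 * (1 + 2 * q)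
  potential-start {o} q b∈ q+1≡c = trans (cong potential (sym (ℕP.+-identityʳ o))) (potential-pendant 0 q b∈ q+1≡c)

  record LocallyHarmonic (v : ℕ) : Set where
    field
      {nbr}   : ℕ
      {nbrs}  : List ℕ
      nbrs-↭  : neighbours G v ↭ nbr ∷ nbrs
      balance : potential v * length (nbr ∷ nbrs) ≡ length (nbr ∷ nbrs) + sum (map potential (nbr ∷ nbrs))

  harmonic-via : ∀ {v w ws V Ws} → neighbours G v ↭ w ∷ ws → potential v ≡ V → map potential (w ∷ ws) ≡ Ws →
                 V * length (w ∷ ws) ≡ length (w ∷ ws) + sum Ws → LocallyHarmonic v
  harmonic-via {w = w} {ws} nbrs-↭ pv≡V map≡Ws identity = record
    { nbrs-↭  = nbrs-↭
    ; balance = trans (cong (_* length (w ∷ ws)) pv≡V)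
                      (trans identity (cong (λ Ws → length (w ∷ ws) + sum Ws) (sym map≡Ws)))
    }

  harmonic-spine-end : LocallyHarmonic 0
  harmonic-spine-end =
    harmonic-via neighbours-spine-end
      (potential-left 0 a refl) (cong (_∷ []) (potential-left 1 a₀ refl)) (identity fₐ a₀)
    where
    identity : ∀ F b → (F + suc b * (suc b + 2 * 0)) * 1 ≡ 1 + (F + b * (b + 2 * 1) + 0)
    identity = solve-∀

  harmonic-spine-left : ∀ {y b} → suc (suc y) + b ≡ a → LocallyHarmonic (suc y)
  harmonic-spine-left {y} {b} y+2+b≡a =
    harmonic-via (neighbours-spine-inner y+2<n y+1≢a)
      (potential-left (suc y) (suc b) y+1+b+1≡a)
      (cong₂ _∷_ (potential-left y (suc (suc b)) y+b+2≡a)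
                 (cong (_∷ []) (potential-left (suc (suc y)) b y+2+b≡a)))
      (identity fₐ y b)
    where
    y+1+b+1≡a : suc y + suc b ≡ a
    y+1+b+1≡a = proj₁ (shift₂ {y} {b} y+2+b≡a)
    y+b+2≡a : y + suc (suc b) ≡ a
    y+b+2≡a = proj₂ (shift₂ {y} {b} y+2+b≡a)
    y+2<n : suc (suc y) < n
    y+2<n = ℕP.≤-<-trans (m+n≡o⇒m≤o y+2+b≡a) (ℕP.<-trans (ℕP.n<1+n a) a+1<n)
    y+1≢a : suc y ≢ a
    y+1≢a = ℕP.<⇒≢ (m+[1+n]≡o⇒m<o y+1+b+1≡a)
    identity : ∀ F y b → (F + suc b * (suc b + 2 * suc y)) * 2
                       ≡ 2 + (F + suc (suc b) * (suc (suc b) + 2 * y) + (F + b * (b + 2 * suc (suc y)) + 0))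
    identity = solve-∀

  harmonic-spine-right : ∀ {y r} → a ≤ y → suc (suc y) + suc r ≡ n → LocallyHarmonic (suc y)
  harmonic-spine-right {y} {r} a≤y y+2+r+1≡n =
    harmonic-via (neighbours-spine-inner (m+[1+n]≡o⇒m<o y+2+r+1≡n) y+1≢a)
      (potential-right (suc y) (suc r) (ℕP.m≤n⇒m≤1+n a≤y) y+1+r+2≡n)
      (cong₂ _∷_ (potential-right y (suc (suc r)) a≤y y+r+3≡n)
                 (cong (_∷ []) (potential-right (suc (suc y)) r (ℕP.m≤n⇒m≤1+n (ℕP.m≤n⇒m≤1+n a≤y)) y+2+r+1≡n)))
      (identity y r d)
    where
    y+1+r+2≡n : suc y + suc (suc r) ≡ n
    y+1+r+2≡n = proj₁ (shift₂ {y} {suc r} y+2+r+1≡n)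
    y+r+3≡n : y + suc (suc (suc r)) ≡ n
    y+r+3≡n = proj₂ (shift₂ {y} {suc r} y+2+r+1≡n)
    y+1≢a : suc y ≢ a
    y+1≢a = ℕP.>⇒≢ (s≤s a≤y)
    identity : ∀ y r d → suc r * (suc r + 2 * suc y + 2 * d) * 2
                       ≡ 2 + (suc (suc r) * (suc (suc r) + 2 * y + 2 * d) + (r * (r + 2 * suc (suc y) + 2 * d) + 0))
    identity = solve-∀

  sum-starts : sum (map potential starts) + length starts ≡ length starts * fₐ + 2 * d
  sum-starts =
    trans (over pendants start-value) (cong (λ cs′ → length starts * fₐ + 2 * sum cs′) (blocks-sizes n cs))
    where
    start-value : ∀ {o c} → (o , c) ∈ pendants → potential o + 1 ≡ fₐ + 2 * c
    start-value {o} {c} b∈ with ℕP.m≤n⇒∃[o]m+o≡n (blocks-All cs≥1 b∈)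
    ... | q , refl = trans (cong (_+ 1) (potential-start q b∈ refl)) (identity fₐ q)
      where
      identity : ∀ F q → F + 1 * (1 + 2 * q) + 1 ≡ F + 2 * suc q
      identity = solve-∀
    over : ∀ bs → (∀ {o c} → (o , c) ∈ bs → potential o + 1 ≡ fₐ + 2 * c) →
           sum (map potential (map proj₁ bs)) + length (map proj₁ bs)
           ≡ length (map proj₁ bs) * fₐ + 2 * sum (map proj₂ bs)
    over []             _      = refl
    over ((o , c) ∷ bs) values = begin
      potential o + S + suc l              ≡⟨ regroup (potential o) S l ⟩
      (potential o + 1) + (S + l)          ≡⟨ cong₂ _+_ (values (here refl)) (over bs (λ b∈ → values (there b∈))) ⟩
      (fₐ + 2 * c) + (l * fₐ + 2 * Σc)     ≡⟨ collect fₐ c l Σc ⟩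
      suc l * fₐ + 2 * (c + Σc)            ∎
      where
      open ≡-Reasoning
      S l Σc : ℕ
      S  = sum (map potential (map proj₁ bs))
      l  = length (map proj₁ bs)
      Σc = sum (map proj₂ bs)
      regroup : ∀ x S l → x + S + suc l ≡ (x + 1) + (S + l)
      regroup = solve-∀
      collect : ∀ F c l Σ → (F + 2 * c) + (l * F + 2 * Σ) ≡ suc l * F + 2 * (c + Σ)
      collect = solve-∀

  harmonic-attachment : LocallyHarmonic a
  harmonic-attachment with ℕP.m≤n⇒∃[o]m+o≡n a+1<n
  ... | r , a+2+r≡n =
    harmonic-via neighbours-attachment potential-a
      (cong₂ _∷_ (potential-left a₀ 1 (ℕP.+-comm a₀ 1))
                 (cong₂ _∷_ (potential-right (suc a) r (ℕP.n≤1+n a) a+1+r+1≡n) refl))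
      balance
    where
    a+1+r+1≡n : suc a + suc r ≡ n
    a+1+r+1≡n = trans (ℕP.+-suc (suc a) r) a+2+r≡n
    fₐ≡ : fₐ ≡ suc r * (suc r + 2 * a + 2 * d)
    fₐ≡ = rightPotential-value a (suc r) (trans (ℕP.+-suc a (suc r)) a+1+r+1≡n)
    m S A B : ℕ
    m = length starts
    S = sum (map potential starts)
    A = fₐ + 1 * (1 + 2 * a₀)
    B = r * (r + 2 * suc a + 2 * d)
    balance : fₐ * suc (suc m) ≡ suc (suc m) + (A + (B + S))
    balance = begin
      fₐ * suc (suc m)                  ≡⟨ cong (_* suc (suc m)) fₐ≡ ⟩
      F * suc (suc m)                   ≡⟨ expand a₀ r d m ⟩
      m * F + 2 * d + (2 + (F + 1 * (1 + 2 * a₀)) + B)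
                                        ≡⟨ cong (λ F → m * F + 2 * d + (2 + (F + 1 * (1 + 2 * a₀)) + B)) fₐ≡ ⟨
      m * fₐ + 2 * d + (2 + A + B)      ≡⟨ cong (_+ (2 + A + B)) sum-starts ⟨
      S + m + (2 + A + B)               ≡⟨ regroup S m A B ⟩
      suc (suc m) + (A + (B + S))       ∎
      where
      open ≡-Reasoning
      F : ℕ
      F = suc r * (suc r + 2 * a + 2 * d)
      expand : ∀ a₀ r d m → suc r * (suc r + 2 * suc a₀ + 2 * d) * suc (suc m)
             ≡ m * (suc r * (suc r + 2 * suc a₀ + 2 * d)) + 2 * d
               + (2 + (suc r * (suc r + 2 * suc a₀ + 2 * d) + 1 * (1 + 2 * a₀)) + r * (r + 2 * suc (suc a₀) + 2 * d))
      expand = solve-∀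
      regroup : ∀ S m A B → S + m + (2 + A + B) ≡ suc (suc m) + (A + (B + S))
      regroup = solve-∀

  harmonic-pendant-leaf : ∀ {o} → (o , 1) ∈ pendants → LocallyHarmonic o
  harmonic-pendant-leaf b∈ =
    harmonic-via (neighbours-pendant-leaf b∈)
      (potential-start 0 b∈ refl) (cong (_∷ []) potential-a) (identity fₐ)
    where
    identity : ∀ F → (F + 1 * (1 + 2 * 0)) * 1 ≡ 1 + (F + 0)
    identity = solve-∀

  harmonic-pendant-root : ∀ {o q} → (o , suc (suc q)) ∈ pendants → LocallyHarmonic o
  harmonic-pendant-root {o} {q} b∈ =
    harmonic-via (neighbours-pendant-root b∈)
      (potential-start (suc q) b∈ refl)
      (cong₂ _∷_ potential-a (cong (_∷ []) (potential-pendant 1 q b∈ refl)))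
      (identity fₐ q)
    where
    identity : ∀ F q → (F + 1 * (1 + 2 * suc q)) * 2 ≡ 2 + (F + (F + 2 * (2 + 2 * q) + 0))
    identity = solve-∀

  harmonic-pendant-end : ∀ {o p} → (o , suc (suc p)) ∈ pendants → LocallyHarmonic (o + suc p)
  harmonic-pendant-end {o} {p} b∈ =
    harmonic-via (neighbours-pendant-end b∈)
      (potential-pendant (suc p) 0 b∈ (ℕP.+-comm (suc p) 1))
      (cong (_∷ []) (potential-pendant p 1 b∈ (ℕP.+-comm p 2)))
      (identity fₐ p)
    where
    identity : ∀ F p → (F + suc (suc p) * (suc (suc p) + 2 * 0)) * 1 ≡ 1 + (F + suc p * (suc p + 2 * 1) + 0)
    identity = solve-∀

  harmonic-pendant-inner : ∀ {o c p q} → (o , c) ∈ pendants → suc (suc p) + suc q ≡ c →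
                           LocallyHarmonic (o + suc p)
  harmonic-pendant-inner {o} {c} {p} {q} b∈ p+2+q+1≡c =
    harmonic-via (neighbours-pendant-inner b∈ (m+[1+n]≡o⇒m<o p+2+q+1≡c))
      (potential-pendant (suc p) (suc q) b∈ p+1+q+2≡c)
      (cong₂ _∷_ (potential-pendant p (suc (suc q)) b∈ p+q+3≡c)
                 (cong (_∷ []) (potential-pendant (suc (suc p)) q b∈ p+2+q+1≡c)))
      (identity fₐ p q)
    where
    p+1+q+2≡c : suc p + suc (suc q) ≡ c
    p+1+q+2≡c = proj₁ (shift₂ {p} {suc q} p+2+q+1≡c)
    p+q+3≡c : p + suc (suc (suc q)) ≡ c
    p+q+3≡c = proj₂ (shift₂ {p} {suc q} p+2+q+1≡c)
    identity : ∀ F p q → (F + suc (suc p) * (suc (suc p) + 2 * suc q)) * 2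
                       ≡ 2 + (F + suc p * (suc p + 2 * suc (suc q))
                              + (F + suc (suc (suc p)) * (suc (suc (suc p)) + 2 * q) + 0))
    identity = solve-∀

  harmonic-spine : ∀ {p} → p < n → p ≢ n ∸ 1 → LocallyHarmonic p
  harmonic-spine {p} p<n p≢u with ℕP.<-cmp p a
  ... | tri≈ _ refl _ = harmonic-attachment
  harmonic-spine {zero}  p<n p≢u | tri< _ _ _ = harmonic-spine-end
  harmonic-spine {suc y} p<n p≢u | tri< y+1<a _ _ with ℕP.m≤n⇒∃[o]m+o≡n y+1<a
  ... | b , y+2+b≡a = harmonic-spine-left y+2+b≡a
  harmonic-spine {suc y} p<n p≢u | tri> _ _ a<y+1 with ℕP.m≤n⇒∃[o]m+o≡n (≢pred⇒suc< p<n p≢u)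
  ... | r , y+3+r≡n = harmonic-spine-right (ℕP.≤-pred a<y+1) (trans (ℕP.+-suc (suc (suc y)) r) y+3+r≡n)

  harmonic-pendant : ∀ {o c p} → (o , c) ∈ pendants → p < c → LocallyHarmonic (o + p)
  harmonic-pendant {o} {c} {p} b∈ p<c with ℕP.m≤n⇒∃[o]m+o≡n p<c
  harmonic-pendant {o} {p = zero}  b∈ _ | zero  , refl =
    subst LocallyHarmonic (sym (ℕP.+-identityʳ o)) (harmonic-pendant-leaf b∈)
  harmonic-pendant {o} {p = zero}  b∈ _ | suc q , refl =
    subst LocallyHarmonic (sym (ℕP.+-identityʳ o)) (harmonic-pendant-root b∈)
  harmonic-pendant {o} {p = suc p} b∈ _ | zero  , refl =
    harmonic-pendant-end (subst (λ c → (o , c) ∈ pendants) (cong (λ x → suc (suc x)) (ℕP.+-identityʳ p)) b∈)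
  harmonic-pendant {o} {p = suc p} b∈ _ | suc q , refl = harmonic-pendant-inner b∈ refl

  harmonic : ∀ {v} → v < size G → v ≢ n ∸ 1 → LocallyHarmonic v
  harmonic {v} v<size v≢u with blocks-cover {0} (n ∷ cs) v v<size
  ... | _ , _ , p , here refl , p<n , refl = harmonic-spine p<n v≢u
  ... | o , c , p , there b∈ , p<c , refl = harmonic-pendant b∈ p<c

  n∸1+1≡n : n ∸ 1 + 1 ≡ n
  n∸1+1≡n = ℕP.m∸n+n≡m (ℕP.<-trans (s≤s z≤n) 1<n)

  solvesHittingEquations : HittingTimes.SolvesHittingEquations G (n ∸ 1) potential
  solvesHittingEquations = record
    { at-target   = potential-right (n ∸ 1) 0 (ℕP.<⇒≤pred a<n) n∸1+1≡n
    ; nonisolated = λ v<size v≢u → let open LocallyHarmonic (harmonic v<size v≢u) in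
                      subst NonZero (sym (↭-length nbrs-↭)) _
    ; harmonic    = λ {v} v<size v≢u → let open LocallyHarmonic (harmonic v<size v≢u) in
                      subst₂ (λ D S → potential v * D ≡ D + S)
                             (sym (↭-length nbrs-↭)) (sym (sum-↭ (map⁺ potential nbrs-↭))) balance
    }

  hittingTime-potential : ∀ {s} → s < n → HittingTime G s (n ∸ 1) (fromℕ (potential s))
  hittingTime-potential s<n = HittingTimes.hittingTime G (n ∸ 1) _ solvesHittingEquations
    (ℕP.<-≤-trans (m+[1+n]≡o⇒m<o n∸1+1≡n) (ℕP.m≤m+n n d)) (ℕP.<-≤-trans s<n (ℕP.m≤m+n n d))

  hittingTime-near : ∀ {i} → 1 ≤ i → i ≤ a → HittingTime G (i ∸ 1) (n ∸ 1) (ℤtoℚ (nearFormula n (suc a) i d))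
  hittingTime-near {suc s} _ s<a with ℕP.m≤n⇒∃[o]m+o≡n (ℕP.<⇒≤ s<a) | ℕP.m≤n⇒∃[o]m+o≡n a<n
  ... | b , s+b≡a | r , a+1+r≡n = subst (HittingTime G s (n ∸ 1)) value (hittingTime-potential (ℕP.<-trans s<a a<n))
    where
    a+r+1≡n : a + suc r ≡ n
    a+r+1≡n = trans (ℕP.+-suc a r) a+1+r≡n
    value : fromℕ (potential s) ≡ ℤtoℚ (nearFormula n (suc a) (suc s) d)
    value = trans (fromℕ-def (potential s)) (cong ℤtoℚ (trans
      (cong ℤ.+_ (trans (potential-left s b s+b≡a) (cong (_+ b * (b + 2 * s)) (rightPotential-value a r a+r+1≡n))))
      (near-closed s b r d refl s+b≡a refl a+r+1≡n)))

  hittingTime-far : ∀ {i} → suc a ≤ i → i ≤ n ∸ 1 → HittingTime G (i ∸ 1) (n ∸ 1) (ℤtoℚ (farFormula n i d))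
  hittingTime-far {suc s} (s≤s a≤s) i≤n∸1 = subst (HittingTime G s (n ∸ 1)) value (hittingTime-potential s<n)
    where
    s<n : s < n
    s<n = ℕP.<-trans (ℕP.n<1+n s) (≤pred⇒< i≤n∸1)
    r : ℕ
    r = proj₁ (ℕP.m≤n⇒∃[o]m+o≡n s<n)
    s+r+1≡n : s + suc r ≡ n
    s+r+1≡n = trans (ℕP.+-suc s r) (proj₂ (ℕP.m≤n⇒∃[o]m+o≡n s<n))
    value : fromℕ (potential s) ≡ ℤtoℚ (farFormula n (suc s) d)
    value = trans (fromℕ-def (potential s))
      (cong ℤtoℚ (trans (cong ℤ.+_ (potential-right s r a≤s s+r+1≡n)) (far-closed s r d refl s+r+1≡n)))

open import Data.Nat using (zero; s≤s; _∸_)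
open import Data.Integer using (+_; _+_; _-_; _*_)
open import Data.Nat.ListAction using (sum)
open import Data.Product using (_×_; _,_)

theorem7 : (n k : ℕ) (cs : List ℕ) (i : ℕ) →
  3 ≤ n → 2 ≤ k → k ≤ n ∸ 1 → All (1 ≤_) cs →
  ((1 ≤ i → i ≤ k ∸ 1 →
      HittingTime (T n k cs) (spine i) (spine n)
        (ℤtoℚ ((+ n * + n) - (+ k * + k) + (+ 2 * (+ sum cs - + 1)) * (+ n - + k)
               + (+ (k ∸ 1) * + (k ∸ 1)) - (+ (i ∸ 1) * + (i ∸ 1)))))
  × (k ≤ i → i ≤ n ∸ 1 →
      HittingTime (T n k cs) (spine i) (spine n)
        (ℤtoℚ ((+ n * + n) - (+ i * + i) + (+ 2 * (+ sum cs - + 1)) * (+ n - + i)))))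
-- The hypothesis 3 ≤ n is implied by 2 ≤ k ≤ n ∸ 1.
theorem7 n zero           cs i _ ()       _     _
theorem7 n (suc zero)     cs i _ (s≤s ()) _     _
theorem7 n (suc (suc a₀)) cs i _ _        k≤n∸1 cs≥1 = hittingTime-near , hittingTime-far
  where open TreePotential n a₀ cs (NatArithmetic.≤pred⇒< k≤n∸1) cs≥1
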